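{- Let $\phi(x,y)$ be a quantifier-free formula over the original vocabulary $\mathcal{V}$, and suppose that $\phi(\{x,y\})\models\neg R(x,x)$. Let the domain be $[n]$ with $1\le m\le n$, and let $\Psi_{[m]}$ be as defined in the context. Let $\omega'$ be an interpretation of the extended vocabulary on $[m]$ such that - $\omega'\models\forall xy.\,\phi(x,y)\land\neg R(x,y)$, and - every element satisfies exactly one of the predicates $A_{\mathbf t}$, $\mathbf t\in T$. Let $\omega''$ be an interpretation of the extended vocabulary on $\{m+1,\dots,n\}$ satisfying $\forall xy.\,\phi(x,y)$, $\mathit{EssentialDAG}(R,d)$ and condition (C). Let $k'_J$ (resp. $k''_J$) be the number of elements realizing the extended $1$-type $J\in[u]\times T$ in $\omega'$ (resp. $\omega''$). Then the number of interpretations $\omega$ on $[n]$ with $$\omega\downarrow[m]=\omega',\qquad \omega\downarrow\{m+1,\dots,n\}=\omega'',\qquad \omega\models\Psi_{[m]}$$ equals $$N(\phi,\mathbf k',\mathbf k''):=\prod_{(j,\mathbf t)\in[u]\times T}\Big(g(\mathbf k'',\mathbf t)\prod_{i\in[u]}c_{ij}^{\,t_i}\,d_{ij}^{\,\alpha(\mathbf k'')_i-t_i}\Big)^{k'_{(j,\mathbf t)}}.$$ Here: - $g(\mathbf k'',\mathbf t):=\prod_{i\in[u]}\binom{\alpha(\mathbf k'')_i}{t_i}-\sum_{i\in[u]:\,t_i>0}k''_{(i,\mathbf t^{ -i})}$, where $\mathbf t^{ -i}$ is $\mathbf t$ with its $i$-th entry decreased by $1$; - $c_{ij}:=\sum_{l\in[b]}c_{ijl}$,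 where $c_{ijl}=1$ if $ijl(x,y)\models\phi(\{x,y\})\land R(x,y)\land\neg R(y,x)$ and $c_{ijl}=0$ otherwise; - $d_{ij}:=\sum_{l\in[b]}d_{ijl}$, where $d_{ijl}=1$ if $ijl(x,y)\models\phi(\{x,y\})\land\neg R(x,y)\land\neg R(y,x)$ and $d_{ijl}=0$ otherwise.
   Context: Interpretations are taken in Herbrand semantics: an interpretation on a finite domain is a truth assignment to all ground atoms. For $\Delta'\subseteq\Delta$, $\omega\downarrow\Delta'$ is the restriction of $\omega$ to ground atoms involving only elements of $\Delta'$. $[k]=\{1,\dots,k\}$. Original vocabulary $\mathcal V$: a finite function-free relational vocabulary containing a binary symbol $R$. $1$-types: a $1$-type is a conjunction of a maximal consistent set of literals (over $\mathcal V$) whose only variable is $x$. There are $u$ of them, enumerated $1,\dots,u$; $i(x)$ denotes the $i$-th. $2$-tables: a $2$-table is a conjunction of a maximal consistent set of literals each containing both variables $x$ and $y$, conjoined with $x\ne y$. There are $b$ of them, enumerated; $l(x,y)$ denotes the $l$-th. $2$-types: $ijl(x,y)$ denotes $i(x)\land j(y)\land l(x,y)$. For quantifier-free $\phi$, $\phi(\{x,y\}):=\phi(x,x)\land\phi(x,y)\land\phi(y,x)\land\phi(y,y)\land x\ne y$. Entailment between such quantifier-free formulas is checked propositionally, treating atoms as propositional variables. Graph of $R$: $\omega_R$ is the directed graph with an edge $c\to e$ iff $\omega\models R(c,e)$. A DAG is essential if no edge $a\to b$ is unprotected, where $a\to b$ is unprotected iff $\mathrm{pa}(b)=\mathrm{pa}(a)\cup\{a\}$.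 $\omega\models\mathit{EssentialDAG}(R,d)$ means $\omega_R$ is an essential DAG with all indegrees at most $d$. Extended vocabulary: let $T=\{\mathbf t=(t_1,\dots,t_u)\in\mathbb N^u:\ t_1+\dots+t_u\le d\}$. The extended vocabulary adds a unary predicate $A_{\mathbf t}$ for each $\mathbf t\in T$. Condition (C): for every element $y$ and every $\mathbf t\in T$, $A_{\mathbf t}(y)$ holds iff, for each $i\in[u]$, exactly $t_i$ elements $x$ satisfy $i(x)\land R(x,y)$. Extended $1$-types: an element has extended $1$-type $(i,\mathbf t)\in[u]\times T$ if it realizes the $1$-type $i$, satisfies $A_{\mathbf t}$, and satisfies no other $A_{\mathbf t'}$. For a vector $\mathbf k$ indexed by $[u]\times T$, $\alpha(\mathbf k)_i:=\sum_{\mathbf t\in T}k_{(i,\mathbf t)}$. $\Psi_{[m]}$: $\omega\models\Psi_{[m]}$ means that $\omega$ satisfies $\forall xy.\,\phi(x,y)$, $\mathit{EssentialDAG}(R,d)$ and condition (C), and that each of $1,\dots,m$ has outdegree $0$ in $\omega_R$. -}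

module Defs where

open import Data.Nat using (ℕ; zero; suc; _+_; _*_; _∸_; _≤_; _^_)
import Data.Nat.Properties as ℕP
open import Data.Nat.Combinatorics using (_C_)
open import Data.Integer using (ℤ; +_) renaming (_+_ to _+ℤ_; _*_ to _*ℤ_; _-_ to _-ℤ_; _^_ to _^ℤ_)
open import Data.Fin using (Fin; zero; suc; _↑ˡ_; _↑ʳ_)
open import Data.Vec using (Vec; lookup; tabulate; updateAt)
open import Data.Bool using (Bool; true; false; _∧_)
import Data.Bool.Properties as BoolP
import Data.Vec.Properties as VecP
import Data.Product.Properties as ProdP
open import Data.Product using (Σ; _×_; _,_)
open import Data.Sum using (_⊎_)
open import Data.Empty using (⊥)
open import Data.Unit using (⊤)
open import Relation.Nullary using (¬_; does)
open import Relation.Binary.PropositionalEquality using (_≡_)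
open import Function.Bundles using (_↔_; _⇔_; Inverse)
open import Relation.Binary.Construct.Closure.Transitive using (TransClosure)

sumℕ : ∀ {k} → (Fin k → ℕ) → ℕ
sumℕ {zero}  f = 0
sumℕ {suc k} f = f zero + sumℕ (λ i → f (suc i))

prodℕ : ∀ {k} → (Fin k → ℕ) → ℕ
prodℕ {zero}  f = 1
prodℕ {suc k} f = f zero * prodℕ (λ i → f (suc i))

sumℤ : ∀ {k} → (Fin k → ℤ) → ℤ
sumℤ {zero}  f = + 0
sumℤ {suc k} f = f zero +ℤ sumℤ (λ i → f (suc i))

prodℤ : ∀ {k} → (Fin k → ℤ) → ℤ
prodℤ {zero}  f = + 1
prodℤ {suc k} f = f zero *ℤ prodℤ (λ i → f (suc i))

countB : ∀ {k} → (Fin k → Bool) → ℕ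
countB {zero}  f = 0
countB {suc k} f = if′ (f zero) + countB (λ i → f (suc i))
  where
  if′ : Bool → ℕ
  if′ true  = 1
  if′ false = 0

allB : ∀ {k} → (Fin k → Bool) → Bool
allB {zero}  f = true
allB {suc k} f = f zero ∧ allB (λ i → f (suc i))

-- Original vocabulary: p unary and q binary predicate symbols; R is one
-- of the binary symbols.

record Vocab : Set where
  field
    p : ℕ
    q : ℕ
    R : Fin q

module _ (V : Vocab) where
  open Vocab V

  record Str (n : ℕ) : Set where
    field
      un : Fin p → Fin n → Bool
      bi : Fin q → Fin n → Fin n → Bool

  -- an interpretation of the extended vocabulary on domain Fin n;
  -- the extra unary predicates A_t are indexed by Fin τ (an enumeration of T)
  record Interp (τ n : ℕ) : Set where
    field
      str : Str n
      A   : Fin τ → Fin n → Bool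

  -- 1-types: truth values of P(x) (P unary) and Q(x,x) (Q binary)
  OneType : Set
  OneType = Vec Bool p × Vec Bool q

  -- 2-tables: truth values of Q(x,y) and Q(y,x) (Q binary)   (plus x ≠ y)
  TwoTable : Set
  TwoTable = Vec Bool q × Vec Bool q

  data Var : Set where
    vx vy : Var

  infixr 6 _and_
  infixr 5 _or_
  infix 9 _⟨_,_⟩
  data QF : Set where
    tt ff : QF
    un   : Fin p → Var → QF
    bi   : Fin q → Var → Var → QF
    eq   : Var → Var → QF
    neg  : QF → QF
    _and_ _or_ : QF → QF → QF

  sub : QF → (Var → Var) → QF
  sub tt         σ = tt
  sub ff         σ = ff
  sub (un P v)   σ = un P (σ v)
  sub (bi Q v w) σ = bi Q (σ v) (σ w)
  sub (eq v w)   σ = eq (σ v) (σ w)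
  sub (neg ψ)    σ = neg (sub ψ σ)
  sub (ψ and χ)  σ = sub ψ σ and sub χ σ
  sub (ψ or χ)   σ = sub ψ σ or sub χ σ

  _⟨_,_⟩ : QF → Var → Var → QF
  ψ ⟨ a , b ⟩ = sub ψ (λ { vx → a ; vy → b })

  -- φ({x,y}) := φ(x,x) ∧ φ(x,y) ∧ φ(y,x) ∧ φ(y,y) ∧ x ≠ y
  pairForm : QF → QF
  pairForm ψ = ψ ⟨ vx , vx ⟩ and (ψ ⟨ vx , vy ⟩ and (ψ ⟨ vy , vx ⟩
               and (ψ ⟨ vy , vy ⟩ and neg (eq vx vy))))

  ⟦_⟧ : ∀ {n} → QF → Str n → (Var → Fin n) → Set
  ⟦ tt ⟧       S ρ = ⊤
  ⟦ ff ⟧       S ρ = ⊥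
  ⟦ un P v ⟧   S ρ = Str.un S P (ρ v) ≡ true
  ⟦ bi Q v w ⟧ S ρ = Str.bi S Q (ρ v) (ρ w) ≡ true
  ⟦ eq v w ⟧   S ρ = ρ v ≡ ρ w
  ⟦ neg ψ ⟧    S ρ = ¬ ⟦ ψ ⟧ S ρ
  ⟦ ψ and χ ⟧  S ρ = ⟦ ψ ⟧ S ρ × ⟦ χ ⟧ S ρ
  ⟦ ψ or χ ⟧   S ρ = ⟦ ψ ⟧ S ρ ⊎ ⟦ χ ⟧ S ρ

  env : ∀ {n} → Fin n → Fin n → Var → Fin n
  env c e vx = c
  env c e vy = e

  tp : ∀ {n} → Str n → Fin n → OneType
  tp S c = tabulate (λ P → Str.un S P c) , tabulate (λ Q → Str.bi S Q c c)

  tb : ∀ {n} → Str n → Fin n → Fin n → TwoTable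
  tb S c e = tabulate (λ Q → Str.bi S Q c e) , tabulate (λ Q → Str.bi S Q e c)

  -- propositional entailment between quantifier-free formulas in x, y:
  -- every assignment to the ground atoms over two distinct elements
  -- x ↦ 0, y ↦ 1 satisfying ψ satisfies χ.
  x0 y1 : Fin 2
  x0 = zero
  y1 = suc zero

  _⊨_ : QF → QF → Set
  ψ ⊨ χ = (S : Str 2) → ⟦ ψ ⟧ S (env x0 y1) → ⟦ χ ⟧ S (env x0 y1)

  -- ijl(x,y) ⊨ χ  (the 2-type i(x) ∧ j(y) ∧ l(x,y) entails χ)
  Ent2 : OneType → OneType → TwoTable → QF → Set
  Ent2 ti tj tl χ = (S : Str 2) → tp S x0 ≡ ti → tp S y1 ≡ tj → tb S x0 y1 ≡ tl
                    → ⟦ χ ⟧ S (env x0 y1)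

  restrL : ∀ {τ} m r → Interp τ (m + r) → Interp τ m
  restrL m r ω = record
    { str = record { un = λ P c → Str.un (Interp.str ω) P (c ↑ˡ r)
                   ; bi = λ Q c e → Str.bi (Interp.str ω) Q (c ↑ˡ r) (e ↑ˡ r) }
    ; A = λ k c → Interp.A ω k (c ↑ˡ r) }

  restrR : ∀ {τ} m r → Interp τ (m + r) → Interp τ r
  restrR m r ω = record
    { str = record { un = λ P c → Str.un (Interp.str ω) P (m ↑ʳ c)
                   ; bi = λ Q c e → Str.bi (Interp.str ω) Q (m ↑ʳ c) (m ↑ʳ e) }
    ; A = λ k c → Interp.A ω k (m ↑ʳ c) }

  _≈I_ : ∀ {τ n} → Interp τ n → Interp τ n → Set
  ω₁ ≈I ω₂ = (∀ P c → Str.un (Interp.str ω₁) P c ≡ Str.un (Interp.str ω₂) P c)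
           × (∀ Q c e → Str.bi (Interp.str ω₁) Q c e ≡ Str.bi (Interp.str ω₂) Q c e)
           × (∀ k c → Interp.A ω₁ k c ≡ Interp.A ω₂ k c)

  -- "exactly N interpretations satisfy Pr" (counted up to equality of
  -- interpretations as truth assignments)
  IsCount : ∀ {τ n} → (Interp τ n → Set) → ℕ → Set
  IsCount {τ} {n} Pr N =
    Σ (Fin N → Interp τ n) λ f →
        (∀ a → Pr (f a))
      × (∀ a a′ → f a ≈I f a′ → a ≡ a′)
      × (∀ ω → Pr ω → Σ (Fin N) λ a → f a ≈I ω)

  _≟T_ : (a b : OneType) → _
  _≟T_ = ProdP.≡-dec (VecP.≡-dec BoolP._≟_) (VecP.≡-dec BoolP._≟_)

  module Ctx {u : ℕ} (e1 : Fin u ↔ OneType) {τ : ℕ} (enumT : Fin τ → Vec ℕ u)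
             (d : ℕ) where

    realizes : ∀ {n} → Str n → Fin n → Fin u → Bool
    realizes S c i = does (tp S c ≟T Inverse.to e1 i)

    Rb : ∀ {n} → Interp τ n → Fin n → Fin n → Bool
    Rb ω = Str.bi (Interp.str ω) R

    SatAll : ∀ {n} → QF → Interp τ n → Set
    SatAll ψ ω = ∀ c e → ⟦ ψ ⟧ (Interp.str ω) (env c e)

    Edge : ∀ {n} → Interp τ n → Fin n → Fin n → Set
    Edge ω c e = Rb ω c e ≡ true

    Unprotected : ∀ {n} → Interp τ n → Fin n → Fin n → Set
    Unprotected ω a b = Edge ω a b × (∀ c → Edge ω c b ⇔ (Edge ω c a ⊎ c ≡ a))

    EssentialDAG : ∀ {n} → Interp τ n → Set
    EssentialDAG ω = (∀ c → ¬ TransClosure (Edge ω) c c)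
                   × (∀ a b → ¬ Unprotected ω a b)
                   × (∀ b → countB (λ c → Rb ω c b) ≤ d)

    CondC : ∀ {n} → Interp τ n → Set
    CondC ω = ∀ y k → (Interp.A ω k y ≡ true)
                ⇔ (∀ i → countB (λ x → realizes (Interp.str ω) x i ∧ Rb ω x y)
                          ≡ lookup (enumT k) i)

    hasExt : ∀ {n} → Interp τ n → Fin n → Fin u → Vec ℕ u → Bool
    hasExt ω c i t = realizes (Interp.str ω) c i
      ∧ allB (λ k → does (Interp.A ω k c BoolP.≟ does (VecP.≡-dec ℕP._≟_ (enumT k) t)))

    kext : ∀ {n} → Interp τ n → Fin u → Vec ℕ u → ℕ
    kext ω i t = countB (λ c → hasExt ω c i t)

    Ψ : QF → ∀ m r → Interp τ (m + r) → Set
    Ψ φ m r ω = SatAll φ ω × EssentialDAG ω × CondC ω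
              × (∀ (c : Fin m) e → Rb ω (c ↑ˡ r) e ≡ false)

    whenPos : ℕ → ℤ → ℤ
    whenPos zero    z = + 0
    whenPos (suc _) z = z

    module Formula (cc dd : Fin u → Fin u → ℕ)
                   (k′ k″ : Fin u → Vec ℕ u → ℕ) where
      α″ : Fin u → ℕ
      α″ i = sumℕ (λ k → k″ i (enumT k))

      g : Vec ℕ u → ℤ
      g t = prodℤ (λ i → + (α″ i C lookup t i))
            -ℤ sumℤ (λ i → whenPos (lookup t i) (+ k″ i (updateAt t i (λ x → x ∸ 1))))

      N : ℤ
      N = prodℤ λ j → prodℤ λ k →
            (g (enumT k) *ℤ
               + prodℕ (λ i → (cc i j ^ lookup (enumT k) i)
                              * (dd i j ^ (α″ i ∸ lookup (enumT k) i))))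
            ^ℤ k′ j (enumT k)

-- The elements of [m] are sinks and carry no R-edges among themselves, so an extension ω
-- of ω′ and ω″ is determined by its row of 2-tables between each new element c and the old
-- elements {m+1,…,n}, and Ψ_[m] splits into independent conditions on these rows.  If c has
-- extended 1-type (j, t), a row is good iff its set S of old R-parents of c has t_i members
-- of each 1-type i, every 2-table is allowed by φ (c_ij choices towards a parent, d_ij
-- towards a non-parent), and no edge a → c is unprotected, i.e. S is not the family
-- pa(a) ∪ {a} of a member a.  There are ∏_i C(α_i, t_i) sets S with the right counts.
-- Acyclicity of ω″ makes distinct families distinct, and the family of an old a of 1-type i
-- has counts t iff a has extended 1-type (i, t⁻ⁱ); this gives the subtracted sum in
-- g(k″, t).  Each good S admits ∏_i c_ij^t_i d_ij^(α_i − t_i) fillings, and grouping the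
-- new elements by extended 1-type turns the product of the row counts into N(φ, k′, k″).

module Submission where

open import Defs

open import Data.Nat using (ℕ; zero; suc; _+_; _*_; _∸_; _≤_; _^_)
import Data.Nat.Properties as ℕP
import Algebra.Properties.CommutativeMonoid.Sum as MonoidSum
open import Algebra.Properties.CommutativeSemigroup ℕP.*-commutativeSemigroup using (x∙yz≈y∙xz)
open import Data.Nat.Combinatorics using (_C_; nCk+nC[k+1]≡[n+1]C[k+1]; k>n⇒nCk≡0)
open import Data.Integer as ℤ using (ℤ) renaming (+_ to pos)
import Data.Integer.Properties as ℤP
open import Data.Fin using (Fin; zero; suc; _↑ˡ_; _↑ʳ_; splitAt; combine; remQuot; _≟_)
import Data.Fin.Properties as FinP
open import Data.Vec using (Vec; lookup; tabulate; updateAt)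
import Data.Vec as Vec
import Data.Vec.Properties as VecP
open import Data.Bool using (Bool; true; false; _∧_; _∨_; not; if_then_else_)
import Data.Bool.Properties as BoolP
open import Data.Product using (Σ; _×_; _,_; proj₁; proj₂)
open import Data.Sum using (_⊎_; inj₁; inj₂)
open import Data.Empty using (⊥-elim)
open import Relation.Nullary using (¬_; Dec; yes; no; does)
open import Relation.Nullary.Decidable using (dec-true; dec-false; ¬?; _→-dec_)
open import Data.Vec.Functional as Vector using ()
open import Data.Vec.Functional.Relation.Binary.Pointwise using (Pointwise)
open import Data.Product.Relation.Binary.Pointwise.NonDependent using () renaming (Pointwise to ×-Pointwise)
open import Relation.Binary.PropositionalEquality
open import Relation.Binary.Construct.Closure.Transitive using (TransClosure; [_]; _∷_)
open import Function.Definitions using (Injective)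
open import Function.Bundles using (_↔_; _⇔_; mk⇔; Equivalence; Inverse)
import Function.Properties.Equivalence as ⇔
open import Function.Related.TypeIsomorphisms using (¬-cong-⇔)
open import Data.Product.Function.NonDependent.Propositional using (_×-⇔_)
open import Data.Sum.Function.Propositional using (_⊎-⇔_)

≡-⇔ : ∀ {x y : Bool} → x ≡ y → (x ≡ true) ⇔ (y ≡ true)
≡-⇔ x≡y = mk⇔ (trans (sym x≡y)) (trans x≡y)

from-does-true : ∀ {X : Set} (x? : Dec X) → does x? ≡ true → X
from-does-true (yes x) _ = x

-- Counting up to a relation

-- Defs.IsCount for an arbitrary relation _~_ in place of _≈I_
record Count {A : Set} (_~_ : A → A → Set) (P : A → Set) (n : ℕ) : Set where
  field
    elem     : Fin n → A
    valid    : ∀ a → P (elem a)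
    distinct : ∀ a a′ → elem a ~ elem a′ → a ≡ a′
    complete : ∀ x → P x → Σ (Fin n) λ a → elem a ~ x
open Count public

module _ {A : Set} {_~_ : A → A → Set} where

  count-none : ∀ {P : A → Set} → (∀ x → ¬ P x) → Count _~_ P 0
  count-none ¬P = record
    { elem = λ () ; valid = λ () ; distinct = λ () ; complete = λ x p → ⊥-elim (¬P x p) }

  count-⇔ : ∀ {P Q : A → Set} {n} → (∀ x → P x → Q x) → (∀ x → Q x → P x) →
            Count _~_ P n → Count _~_ Q n
  count-⇔ P⇒Q Q⇒P K = record
    { elem = elem K ; valid = λ a → P⇒Q _ (valid K a) ; distinct = distinct K
    ; complete = λ x q → complete K x (Q⇒P x q) }

  count-unique : ∀ {P : A → Set} {n n′} →
                 (∀ {x y} → x ~ y → y ~ x) → (∀ {x y z} → x ~ y → y ~ z → x ~ z) →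
                 Count _~_ P n → Count _~_ P n′ → n ≡ n′
  count-unique {P} sym~ trans~ K L =
    ℕP.≤-antisym (FinP.injective⇒≤ (match-injective K L)) (FinP.injective⇒≤ (match-injective L K))
    where
    match : ∀ {n n′} → Count _~_ P n → Count _~_ P n′ → Fin n → Fin n′
    match K L a = proj₁ (complete L (elem K a) (valid K a))
    match-injective : ∀ {n n′} (K : Count _~_ P n) (L : Count _~_ P n′) →
                      ∀ {a a′} → match K L a ≡ match K L a′ → a ≡ a′
    match-injective K L {a} {a′} same = distinct K a a′ (trans~ (sym~ (proj₂ (complete L _ (valid K a))))
      (subst (λ z → elem L z ~ elem K a′) (sym same) (proj₂ (complete L _ (valid K a′)))))

count-true : ∀ {k} (D : Fin k → Bool) → Count _≡_ (λ i → D i ≡ true) (countB D)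
count-true {zero} D = count-none (λ ())
count-true {suc k} D with D zero in D₀
... | true = record { elem = elem′ ; valid = valid′ ; distinct = distinct′ ; complete = complete′ }
  where
  K = count-true (λ i → D (suc i))
  elem′ : Fin (suc (countB (λ i → D (suc i)))) → Fin (suc k)
  elem′ zero    = zero
  elem′ (suc a) = suc (elem K a)
  valid′ : ∀ a → D (elem′ a) ≡ true
  valid′ zero    = D₀
  valid′ (suc a) = valid K a
  distinct′ : ∀ a a′ → elem′ a ≡ elem′ a′ → a ≡ a′
  distinct′ zero    zero     _    = refl
  distinct′ (suc a) (suc a′) same = cong suc (distinct K a a′ (FinP.suc-injective same))
  complete′ : ∀ x → D x ≡ true → Σ _ λ a → elem′ a ≡ x
  complete′ zero    _ = zero , refl
  complete′ (suc x) p = suc (proj₁ (complete K x p)) , cong suc (proj₂ (complete K x p))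
... | false = record
  { elem = λ a → suc (elem K a) ; valid = valid K
  ; distinct = λ a a′ same → distinct K a a′ (FinP.suc-injective same) ; complete = complete′ }
  where
  K = count-true (λ i → D (suc i))
  complete′ : ∀ x → D x ≡ true → Σ _ λ a → suc (elem K a) ≡ x
  complete′ zero    p with () ← trans (sym D₀) p
  complete′ (suc x) p = proj₁ (complete K x p) , cong suc (proj₂ (complete K x p))

module _ {A : Set} {_~_ : A → A → Set} where

  count-filter : ∀ {P Q : A → Set} {n} (K : Count _~_ P n) (Q? : ∀ x → Dec (Q x)) →
                 (∀ {x y} → x ~ y → Q y → Q x) →
                 Count _~_ (λ x → P x × Q x) (countB (λ a → does (Q? (elem K a))))
  count-filter {P} {Q} K Q? Q-resp = record
    { elem = λ a → elem K (elem L a)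
    ; valid = λ a → valid K (elem L a) , from-does-true (Q? _) (valid L a)
    ; distinct = λ a a′ same → distinct L a a′ (distinct K _ _ same)
    ; complete = complete′ }
    where
    L = count-true (λ a → does (Q? (elem K a)))
    complete′ : ∀ x → P x × Q x → Σ _ λ a → elem K (elem L a) ~ x
    complete′ x (p , q) with complete K x p
    ... | i , i~x with complete L i (dec-true (Q? (elem K i)) (Q-resp i~x q))
    ... | a , refl = a , i~x

  count-+ : ∀ {P Q : A → Set} {n₁ n₂} → (∀ {x y} → x ~ y → y ~ x) → (∀ {x y} → x ~ y → Q x → Q y) →
            (∀ x → Dec (Q x)) →
            Count _~_ (λ x → P x × Q x) n₁ → Count _~_ (λ x → P x × ¬ Q x) n₂ → Count _~_ P (n₁ + n₂)
  count-+ {P} {Q} {n₁} {n₂} sym~ Q-resp Q? K L = record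
    { elem = λ a → elem′ (splitAt n₁ a) ; valid = λ a → valid′ (splitAt n₁ a)
    ; distinct = λ a a′ same → distinct′ a a′ (splitAt n₁ a) (splitAt n₁ a′) refl refl same
    ; complete = complete′ }
    where
    elem′ : Fin n₁ ⊎ Fin n₂ → A
    elem′ (inj₁ a) = elem K a
    elem′ (inj₂ a) = elem L a
    valid′ : ∀ z → P (elem′ z)
    valid′ (inj₁ a) = proj₁ (valid K a)
    valid′ (inj₂ a) = proj₁ (valid L a)
    distinct′ : ∀ a a′ z z′ → splitAt n₁ a ≡ z → splitAt n₁ a′ ≡ z′ → elem′ z ~ elem′ z′ → a ≡ a′
    distinct′ a a′ (inj₁ b) (inj₁ b′) s s′ same with refl ← distinct K b b′ same =
      trans (sym (FinP.splitAt⁻¹-↑ˡ s)) (FinP.splitAt⁻¹-↑ˡ s′)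
    distinct′ a a′ (inj₂ b) (inj₂ b′) s s′ same with refl ← distinct L b b′ same =
      trans (sym (FinP.splitAt⁻¹-↑ʳ s)) (FinP.splitAt⁻¹-↑ʳ s′)
    distinct′ a a′ (inj₁ b) (inj₂ b′) _ _ same = ⊥-elim (proj₂ (valid L b′) (Q-resp same (proj₂ (valid K b))))
    distinct′ a a′ (inj₂ b) (inj₁ b′) _ _ same = ⊥-elim (proj₂ (valid L b) (Q-resp (sym~ same) (proj₂ (valid K b′))))
    complete′ : ∀ x → P x → Σ _ λ a → elem′ (splitAt n₁ a) ~ x
    complete′ x p with Q? x
    ... | yes q = let (a , a~x) = complete K x (p , q) in
      a ↑ˡ n₂ , subst (λ z → elem′ z ~ x) (sym (FinP.splitAt-↑ˡ n₁ a n₂)) a~x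
    ... | no ¬q = let (a , a~x) = complete L x (p , ¬q) in
      n₁ ↑ʳ a , subst (λ z → elem′ z ~ x) (sym (FinP.splitAt-↑ʳ n₁ n₂ a)) a~x

count-image : ∀ {A B : Set} {_~A_ : A → A → Set} {_~B_ : B → B → Set} {P : A → Set} {Q : B → Set} {n} →
              Count _~A_ P n → (F : A → B) →
              (∀ x → P x → Q (F x)) →
              (∀ x x′ → P x → P x′ → F x ~B F x′ → x ~A x′) →
              (∀ y → Q y → Σ A λ x → P x × (∀ x′ → x′ ~A x → F x′ ~B y)) →
              Count _~B_ Q n
count-image K F P⇒Q F-injective F-surjective = record
  { elem = λ a → F (elem K a)
  ; valid = λ a → P⇒Q _ (valid K a)
  ; distinct = λ a a′ same → distinct K a a′ (F-injective _ _ (valid K a) (valid K a′) same)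
  ; complete = λ y q → let (x , px , onto) = F-surjective y q ; (a , a~x) = complete K x px in
                       a , onto (elem K a) a~x }

count-Σ : ∀ {A B : Set} {_~A_ : A → A → Set} {_~B_ : B → B → Set} {P : A → Set} {Q : A → B → Set} {n w} →
          Count _~A_ P n → (∀ x → P x → Count _~B_ (Q x) w) →
          (∀ {x x′} → x ~A x′ → ∀ {y} → Q x′ y → Q x y) →
          Count (×-Pointwise _~A_ _~B_) (λ (x , y) → P x × Q x y) (n * w)
count-Σ {A} {B} {_~A_} {_~B_} {P} {Q} {n} {w} K fibre Q-resp = record
  { elem = λ k → elem′ (remQuot w k) ; valid = λ k → valid′ (remQuot w k)
  ; distinct = distinct′ ; complete = complete′ }
  where
  elem′ : Fin n × Fin w → A × B
  elem′ (i , j) = elem K i , elem (fibre (elem K i) (valid K i)) j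
  valid′ : ∀ z → P (proj₁ (elem′ z)) × Q (proj₁ (elem′ z)) (proj₂ (elem′ z))
  valid′ (i , j) = valid K i , valid (fibre (elem K i) (valid K i)) j
  pair-distinct : ∀ i j i′ j′ → ×-Pointwise _~A_ _~B_ (elem′ (i , j)) (elem′ (i′ , j′)) →
                  (i , j) ≡ (i′ , j′)
  pair-distinct i j i′ j′ (same₁ , same₂) with refl ← distinct K i i′ same₁
    with refl ← distinct (fibre (elem K i) (valid K i)) j j′ same₂ = refl
  distinct′ : ∀ k k′ → (×-Pointwise _~A_ _~B_) (elem′ (remQuot w k)) (elem′ (remQuot w k′)) → k ≡ k′
  distinct′ k k′ same = begin
    k                                    ≡⟨ FinP.combine-remQuot {n} w k ⟨
    combine (proj₁ kq) (proj₂ kq)        ≡⟨ cong (λ (i , j) → combine i j) (pair-distinct _ _ _ _ same) ⟩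
    combine (proj₁ kq′) (proj₂ kq′)      ≡⟨ FinP.combine-remQuot {n} w k′ ⟩
    k′                                   ∎
    where
    open ≡-Reasoning
    kq = remQuot {n} w k
    kq′ = remQuot {n} w k′
  complete′ : ∀ z → P (proj₁ z) × Q (proj₁ z) (proj₂ z) →
              Σ _ λ k → ×-Pointwise _~A_ _~B_ (elem′ (remQuot w k)) z
  complete′ (x , y) (px , qxy) with complete K x px
  ... | i , i~x with complete (fibre (elem K i) (valid K i)) y (Q-resp i~x qxy)
  ... | j , j~y = combine i j ,
    subst (λ z → (×-Pointwise _~A_ _~B_) (elem′ z) (x , y)) (sym (FinP.remQuot-combine i j)) (i~x , j~y)

count-Π : ∀ {B : Set} {_~_ : B → B → Set} {m} {P : Fin m → B → Set} {n : Fin m → ℕ} →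
          (∀ c → Count _~_ (P c) (n c)) →
          Count (Pointwise _~_) (λ h → ∀ c → P c (h c)) (prodℕ n)
count-Π {m = zero} K = record
  { elem = λ _ () ; valid = λ _ () ; distinct = λ { zero zero _ → refl }
  ; complete = λ _ _ → zero , λ (c : Fin 0) → ⊥-elim (FinP.¬Fin0 c) }
count-Π {_~_ = _~_} {m = suc m} {P} K =
  count-image {_~A_ = ×-Pointwise _~_ (Pointwise _~_)} {_~B_ = Pointwise _~_}
              {P = λ (y , h) → P zero y × (∀ c → P (suc c) (h c))}
    (count-Σ {Q = λ _ h → ∀ c → P (suc c) (h c)} (K zero) (λ _ _ → count-Π (λ c → K (suc c))) (λ _ q → q))
    (λ (y , h) → y Vector.∷ h)
    (λ (y , h) (py , ph) → λ { zero → py ; (suc c) → ph c })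
    (λ _ _ _ _ same → same zero , λ c → same (suc c))
    (λ h ph → (h zero , λ c → h (suc c)) , (ph zero , λ c → ph (suc c)) ,
              λ (y , h′) (y~ , h′~) → λ { zero → y~ ; (suc c) → h′~ c })

private
  module Sum  = MonoidSum ℕP.+-0-commutativeMonoid
  module Prod = MonoidSum ℕP.*-1-commutativeMonoid

bit : Bool → ℕ
bit true  = 1
bit false = 0

sumℕ-cong : ∀ {k} {f g : Fin k → ℕ} → (∀ i → f i ≡ g i) → sumℕ f ≡ sumℕ g
sumℕ-cong {zero}  _   = refl
sumℕ-cong {suc k} f≗g = cong₂ _+_ (f≗g zero) (sumℕ-cong (λ i → f≗g (suc i)))

prodℕ-cong : ∀ {k} {f g : Fin k → ℕ} → (∀ i → f i ≡ g i) → prodℕ f ≡ prodℕ g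
prodℕ-cong {zero}  _   = refl
prodℕ-cong {suc k} f≗g = cong₂ _*_ (f≗g zero) (prodℕ-cong (λ i → f≗g (suc i)))

sumℕ≡sum : ∀ {k} (f : Fin k → ℕ) → sumℕ f ≡ Sum.sum f
sumℕ≡sum {zero}  f = refl
sumℕ≡sum {suc k} f = cong (f zero +_) (sumℕ≡sum (λ i → f (suc i)))

prodℕ≡prod : ∀ {k} (f : Fin k → ℕ) → prodℕ f ≡ Prod.sum f
prodℕ≡prod {zero}  f = refl
prodℕ≡prod {suc k} f = cong (f zero *_) (prodℕ≡prod (λ i → f (suc i)))

sumℕ-zeros : ∀ {k} (f : Fin k → ℕ) → (∀ i → f i ≡ 0) → sumℕ f ≡ 0
sumℕ-zeros {zero}  f _  = refl
sumℕ-zeros {suc k} f f0 rewrite f0 zero = sumℕ-zeros _ (λ i → f0 (suc i))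

sumℕ-+ : ∀ {k} (f g : Fin k → ℕ) → sumℕ (λ i → f i + g i) ≡ sumℕ f + sumℕ g
sumℕ-+ f g = begin
  sumℕ (λ i → f i + g i)    ≡⟨ sumℕ≡sum (λ i → f i + g i) ⟩
  Sum.sum (λ i → f i + g i) ≡⟨ Sum.∑-distrib-+ f g ⟩
  Sum.sum f + Sum.sum g     ≡⟨ cong₂ _+_ (sumℕ≡sum f) (sumℕ≡sum g) ⟨
  sumℕ f + sumℕ g           ∎
  where open ≡-Reasoning

sumℕ-comm : ∀ {k n} (f : Fin k → Fin n → ℕ) →
            sumℕ (λ i → sumℕ (λ a → f i a)) ≡ sumℕ (λ a → sumℕ (λ i → f i a))
sumℕ-comm f = begin
  sumℕ (λ i → sumℕ (λ a → f i a))
    ≡⟨ trans (sumℕ-cong (λ i → sumℕ≡sum (f i))) (sumℕ≡sum (λ i → Sum.sum (f i))) ⟩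
  Sum.sum (λ i → Sum.sum (λ a → f i a))
    ≡⟨ Sum.∑-comm f ⟩
  Sum.sum (λ a → Sum.sum (λ i → f i a))
    ≡⟨ trans (sumℕ-cong (λ a → sumℕ≡sum (λ i → f i a))) (sumℕ≡sum (λ a → Sum.sum (λ i → f i a))) ⟨
  sumℕ (λ a → sumℕ (λ i → f i a))
    ∎
  where open ≡-Reasoning

prodℕ-* : ∀ {k} (f g : Fin k → ℕ) → prodℕ (λ i → f i * g i) ≡ prodℕ f * prodℕ g
prodℕ-* f g = begin
  prodℕ (λ i → f i * g i)    ≡⟨ prodℕ≡prod (λ i → f i * g i) ⟩
  Prod.sum (λ i → f i * g i) ≡⟨ Prod.∑-distrib-+ f g ⟩
  Prod.sum f * Prod.sum g    ≡⟨ cong₂ _*_ (prodℕ≡prod f) (prodℕ≡prod g) ⟨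
  prodℕ f * prodℕ g          ∎
  where open ≡-Reasoning

sumℕ-indicator : ∀ {k} (i₀ : Fin k) s → sumℕ (λ i → bit (does (i₀ ≟ i) ∧ s)) ≡ bit s
sumℕ-indicator {suc k} zero s =
  trans (cong (bit s +_) (sumℕ-zeros {k} _ (λ _ → refl))) (ℕP.+-identityʳ _)
sumℕ-indicator (suc i₀) s = sumℕ-indicator i₀ s

prodℕ-ones : ∀ {k} (f : Fin k → ℕ) → (∀ i → f i ≡ 1) → prodℕ f ≡ 1
prodℕ-ones {zero}  f _  = refl
prodℕ-ones {suc k} f f1 rewrite f1 zero = trans (ℕP.+-identityʳ _) (prodℕ-ones _ (λ i → f1 (suc i)))

prodℕ-zero : ∀ {k} (f : Fin k → ℕ) i → f i ≡ 0 → prodℕ f ≡ 0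
prodℕ-zero f zero    fi0 rewrite fi0 = refl
prodℕ-zero f (suc i) fi0 =
  trans (cong (f zero *_) (prodℕ-zero (λ i → f (suc i)) i fi0)) (ℕP.*-zeroʳ (f zero))

prodℕ-extract : ∀ {k} (f : Fin k → ℕ) i₀ → prodℕ f ≡ f i₀ * prodℕ (λ i → if does (i ≟ i₀) then 1 else f i)
prodℕ-extract f zero = cong (f zero *_) (sym (ℕP.*-identityˡ _))
prodℕ-extract {suc k} f (suc i₀) = begin
  f zero * prodℕ (λ i → f (suc i))  ≡⟨ cong (f zero *_) (prodℕ-extract (λ i → f (suc i)) i₀) ⟩
  f zero * (f (suc i₀) * rest)      ≡⟨ x∙yz≈y∙xz (f zero) (f (suc i₀)) rest ⟩
  f (suc i₀) * (f zero * rest)      ∎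
  where
  open ≡-Reasoning
  rest = prodℕ (λ i → if does (i ≟ i₀) then 1 else f (suc i))

prodℕ-indicator : ∀ {k} (f : Fin k → ℕ) i₀ → prodℕ (λ i → f i ^ bit (does (i ≟ i₀))) ≡ f i₀
prodℕ-indicator f i₀ rewrite prodℕ-extract (λ i → f i ^ bit (does (i ≟ i₀))) i₀
                           | dec-true (i₀ ≟ i₀) refl =
  trans (cong₂ _*_ (ℕP.*-identityʳ (f i₀)) (prodℕ-ones _ (λ i → off i (i ≟ i₀)))) (ℕP.*-identityʳ (f i₀))
  where
  off : ∀ i (i? : Dec (i ≡ i₀)) → (if does i? then 1 else f i ^ bit (does i?)) ≡ 1
  off i (yes _) = refl
  off i (no _)  = refl

countB-suc : ∀ {k} (D : Fin (suc k) → Bool) → countB D ≡ bit (D zero) + countB (λ i → D (suc i))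
countB-suc D with D zero
... | true  = refl
... | false = refl

countB-sumℕ : ∀ {k} (D : Fin k → Bool) → countB D ≡ sumℕ (λ i → bit (D i))
countB-sumℕ {zero}  D = refl
countB-sumℕ {suc k} D = trans (countB-suc D) (cong (bit (D zero) +_) (countB-sumℕ (λ i → D (suc i))))

countB-cong : ∀ {k} {D D′ : Fin k → Bool} → (∀ i → D i ≡ D′ i) → countB D ≡ countB D′
countB-cong {D = D} {D′} D≗D′ =
  trans (countB-sumℕ D) (trans (sumℕ-cong (λ i → cong bit (D≗D′ i))) (sym (countB-sumℕ D′)))

countB-none : ∀ {k} (D : Fin k → Bool) → (∀ i → D i ≡ false) → countB D ≡ 0
countB-none D none = trans (countB-sumℕ D) (sumℕ-zeros _ (λ i → cong bit (none i)))

countB-splitAt : ∀ m {r} (D : Fin (m + r) → Bool) →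
                 countB D ≡ countB (λ c → D (c ↑ˡ r)) + countB (λ e → D (m ↑ʳ e))
countB-splitAt zero    D = refl
countB-splitAt (suc m) {r} D = begin
  countB D
    ≡⟨ countB-suc D ⟩
  bit (D zero) + countB (λ i → D (suc i))
    ≡⟨ cong (bit (D zero) +_) (countB-splitAt m (λ i → D (suc i))) ⟩
  bit (D zero) + (countB (λ c → D (suc (c ↑ˡ r))) + right)
    ≡⟨ ℕP.+-assoc (bit (D zero)) _ right ⟨
  bit (D zero) + countB (λ c → D (suc (c ↑ˡ r))) + right
    ≡⟨ cong (_+ right) (countB-suc (λ c → D (c ↑ˡ r))) ⟨
  countB (λ c → D (c ↑ˡ r)) + right
    ∎
  where
  open ≡-Reasoning
  right = countB (λ e → D (suc m ↑ʳ e))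

countB-partition : ∀ {k} (X S : Fin k → Bool) →
                   countB X ≡ countB (λ e → X e ∧ S e) + countB (λ e → X e ∧ not (S e))
countB-partition X S = begin
  countB X
    ≡⟨ countB-sumℕ X ⟩
  sumℕ (λ e → bit (X e))
    ≡⟨ sumℕ-cong (λ e → split (X e) (S e)) ⟩
  sumℕ (λ e → bit (X e ∧ S e) + bit (X e ∧ not (S e)))
    ≡⟨ sumℕ-+ (λ e → bit (X e ∧ S e)) (λ e → bit (X e ∧ not (S e))) ⟩
  sumℕ (λ e → bit (X e ∧ S e)) + sumℕ (λ e → bit (X e ∧ not (S e)))
    ≡⟨ cong₂ _+_ (countB-sumℕ (λ e → X e ∧ S e)) (countB-sumℕ (λ e → X e ∧ not (S e))) ⟨
  countB (λ e → X e ∧ S e) + countB (λ e → X e ∧ not (S e))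
    ∎
  where
  open ≡-Reasoning
  split : ∀ x s → bit x ≡ bit (x ∧ s) + bit (x ∧ not s)
  split false _     = refl
  split true  true  = refl
  split true  false = refl

countB-complement : ∀ {k} (D : Fin k → Bool) → countB D + countB (λ i → not (D i)) ≡ k
countB-complement {k} D = trans (sym (countB-partition (λ _ → true) D)) (all k)
  where
  all : ∀ k → countB {k} (λ _ → true) ≡ k
  all zero    = refl
  all (suc k) = cong suc (all k)

countB-∨-point : ∀ {k} (X Y : Fin k → Bool) a → Y a ≡ false →
                 countB (λ e → X e ∧ (Y e ∨ does (e ≟ a))) ≡ countB (λ e → X e ∧ Y e) + bit (X a)
countB-∨-point X Y a Ya≡false = begin
  countB (λ e → X e ∧ (Y e ∨ does (e ≟ a)))
    ≡⟨ countB-sumℕ (λ e → X e ∧ (Y e ∨ does (e ≟ a))) ⟩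
  sumℕ (λ e → bit (X e ∧ (Y e ∨ does (e ≟ a))))
    ≡⟨ sumℕ-cong (λ e → split e (e ≟ a)) ⟩
  sumℕ (λ e → bit (X e ∧ Y e) + bit (does (a ≟ e) ∧ X a))
    ≡⟨ sumℕ-+ (λ e → bit (X e ∧ Y e)) (λ e → bit (does (a ≟ e) ∧ X a)) ⟩
  sumℕ (λ e → bit (X e ∧ Y e)) + sumℕ (λ e → bit (does (a ≟ e) ∧ X a))
    ≡⟨ cong₂ _+_ (sym (countB-sumℕ (λ e → X e ∧ Y e))) (sumℕ-indicator a (X a)) ⟩
  countB (λ e → X e ∧ Y e) + bit (X a)
    ∎
  where
  open ≡-Reasoning
  split : ∀ e (e? : Dec (e ≡ a)) →
          bit (X e ∧ (Y e ∨ does e?)) ≡ bit (X e ∧ Y e) + bit (does (a ≟ e) ∧ X a)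
  split e (yes refl) rewrite Ya≡false | dec-true (e ≟ e) refl with X e
  ... | true  = refl
  ... | false = refl
  split e (no e≢a) rewrite dec-false (a ≟ e) (λ a≡e → e≢a (sym a≡e)) | BoolP.∨-identityʳ (Y e) =
    sym (ℕP.+-identityʳ _)

countB-by-class : ∀ {r u} (class : Fin r → Fin u) (S : Fin r → Bool) →
                  countB S ≡ sumℕ (λ i → countB (λ e → does (class e ≟ i) ∧ S e))
countB-by-class class S = begin
  countB S
    ≡⟨ countB-sumℕ S ⟩
  sumℕ (λ e → bit (S e))
    ≡⟨ sumℕ-cong (λ e → sumℕ-indicator (class e) (S e)) ⟨
  sumℕ (λ e → sumℕ (λ i → bit (does (class e ≟ i) ∧ S e)))
    ≡⟨ sumℕ-comm (λ e i → bit (does (class e ≟ i) ∧ S e)) ⟩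
  sumℕ (λ i → sumℕ (λ e → bit (does (class e ≟ i) ∧ S e)))
    ≡⟨ sumℕ-cong (λ i → countB-sumℕ (λ e → does (class e ≟ i) ∧ S e)) ⟨
  sumℕ (λ i → countB (λ e → does (class e ≟ i) ∧ S e))
    ∎
  where open ≡-Reasoning

prodℕ-indicator₂ : ∀ {A B} (F : Fin A → Fin B → ℕ) j₀ k₀ →
                   prodℕ (λ j → prodℕ (λ k → F j k ^ bit (does (j ≟ j₀) ∧ does (k ≟ k₀)))) ≡ F j₀ k₀
prodℕ-indicator₂ F j₀ k₀ = trans (prodℕ-cong row) (prodℕ-indicator (λ j → F j k₀) j₀)
  where
  row : ∀ j → prodℕ (λ k → F j k ^ bit (does (j ≟ j₀) ∧ does (k ≟ k₀))) ≡ F j k₀ ^ bit (does (j ≟ j₀))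
  row j with j ≟ j₀
  ... | yes refl = trans (prodℕ-indicator (F j) k₀) (sym (ℕP.*-identityʳ _))
  ... | no _     = prodℕ-ones (λ k → F j k ^ 0) (λ _ → refl)

prodℕ-regroup : ∀ {A B m} (F : Fin A → Fin B → ℕ) (J : Fin m → Fin A) (K : Fin m → Fin B) →
                prodℕ (λ c → F (J c) (K c))
                ≡ prodℕ (λ j → prodℕ (λ k → F j k ^ countB (λ c → does (j ≟ J c) ∧ does (k ≟ K c))))
prodℕ-regroup {m = zero}  F J K = sym (prodℕ-ones _ (λ j → prodℕ-ones (λ k → F j k ^ 0) (λ k → refl)))
prodℕ-regroup {m = suc m} F J K = begin
  F (J zero) (K zero) * prodℕ (λ c → F (J (suc c)) (K (suc c)))
    ≡⟨ cong₂ _*_ (prodℕ-indicator₂ F (J zero) (K zero))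
                 (sym (prodℕ-regroup F (λ c → J (suc c)) (λ c → K (suc c)))) ⟨
  prodℕ (λ j → prodℕ (λ k → F j k ^ bit (hit j k zero))) * prodℕ (λ j → prodℕ (λ k → F j k ^ hits j k))
    ≡⟨ prodℕ-* (λ j → prodℕ (λ k → F j k ^ bit (hit j k zero))) (λ j → prodℕ (λ k → F j k ^ hits j k)) ⟨
  prodℕ (λ j → prodℕ (λ k → F j k ^ bit (hit j k zero)) * prodℕ (λ k → F j k ^ hits j k))
    ≡⟨ prodℕ-cong (λ j → prodℕ-* (λ k → F j k ^ bit (hit j k zero)) (λ k → F j k ^ hits j k)) ⟨
  prodℕ (λ j → prodℕ (λ k → F j k ^ bit (hit j k zero) * F j k ^ hits j k))
    ≡⟨ prodℕ-cong (λ j → prodℕ-cong (λ k → ℕP.^-distribˡ-+-* (F j k) (bit (hit j k zero)) (hits j k))) ⟨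
  prodℕ (λ j → prodℕ (λ k → F j k ^ (bit (hit j k zero) + hits j k)))
    ≡⟨ prodℕ-cong (λ j → prodℕ-cong (λ k → cong (F j k ^_) (countB-suc (hit j k)))) ⟨
  prodℕ (λ j → prodℕ (λ k → F j k ^ countB (hit j k)))
    ∎
  where
  open ≡-Reasoning
  hit : ∀ j k → Fin (suc m) → Bool
  hit j k c = does (j ≟ J c) ∧ does (k ≟ K c)
  hits : ∀ j k → ℕ
  hits j k = countB (λ c → hit j k (suc c))

sum-tabulate : ∀ {k} (f : Fin k → ℕ) → Vec.sum (tabulate f) ≡ sumℕ f
sum-tabulate {zero}  f = refl
sum-tabulate {suc k} f = cong (f zero +_) (sum-tabulate (λ i → f (suc i)))

lookup-extensionality : ∀ {A : Set} {k} {v w : Vec A k} → (∀ i → lookup v i ≡ lookup w i) → v ≡ w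
lookup-extensionality {v = v} {w} v≗w =
  trans (sym (VecP.tabulate∘lookup v)) (trans (VecP.tabulate-cong v≗w) (VecP.tabulate∘lookup w))

lookup-tabulate-≡ : ∀ {A : Set} {k} (f : Fin k → A) {v : Vec A k} → tabulate f ≡ v → ∀ i → f i ≡ lookup v i
lookup-tabulate-≡ f tab≡v i = trans (sym (VecP.lookup∘tabulate f i)) (cong (λ w → lookup w i) tab≡v)

does-sym : ∀ {k} (i j : Fin k) → does (i ≟ j) ≡ does (j ≟ i)
does-sym i j with i ≟ j
... | yes refl = sym (dec-true (i ≟ i) refl)
... | no i≢j   = sym (dec-false (j ≟ i) (λ j≡i → i≢j (sym j≡i)))

∧-true : ∀ {x y} → x ∧ y ≡ true → x ≡ true × y ≡ true
∧-true {true} {true} _ = refl , refl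

allB-true : ∀ {k} (f : Fin k → Bool) → allB f ≡ true ⇔ (∀ i → f i ≡ true)
allB-true {zero}  f = mk⇔ (λ _ ()) (λ _ → refl)
allB-true {suc k} f = mk⇔ to from
  where
  to : allB f ≡ true → ∀ i → f i ≡ true
  to all-f zero    = proj₁ (∧-true all-f)
  to all-f (suc i) = Equivalence.to (allB-true (λ i → f (suc i))) (proj₂ (∧-true all-f)) i
  from : (∀ i → f i ≡ true) → allB f ≡ true
  from f≡true rewrite f≡true zero = Equivalence.from (allB-true (λ i → f (suc i))) (λ i → f≡true (suc i))

pos-prodℕ : ∀ {k} (f : Fin k → ℕ) → pos (prodℕ f) ≡ prodℤ (λ i → pos (f i))
pos-prodℕ {zero}  f = refl
pos-prodℕ {suc k} f = trans (ℤP.pos-* (f zero) _) (cong (ℤ._*_ (pos (f zero))) (pos-prodℕ (λ i → f (suc i))))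

pos-sumℕ : ∀ {k} (f : Fin k → ℕ) → pos (sumℕ f) ≡ sumℤ (λ i → pos (f i))
pos-sumℕ {zero}  f = refl
pos-sumℕ {suc k} f = trans (ℤP.pos-+ (f zero) _) (cong (ℤ._+_ (pos (f zero))) (pos-sumℕ (λ i → f (suc i))))

pos-^ : ∀ a n → pos (a ^ n) ≡ (pos a) ℤ.^ n
pos-^ a zero    = refl
pos-^ a (suc n) = trans (ℤP.pos-* a (a ^ n)) (cong (ℤ._*_ (pos a)) (pos-^ a n))

pos-∸ : ∀ {a b} → b ≤ a → pos (a ∸ b) ≡ pos a ℤ.- pos b
pos-∸ {a} {b} b≤a = trans (sym (ℤP.⊖-≥ b≤a)) (sym (ℤP.m-n≡m⊖n a b))

prodℤ-cong : ∀ {k} {f g : Fin k → ℤ} → (∀ i → f i ≡ g i) → prodℤ f ≡ prodℤ g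
prodℤ-cong {zero}  _   = refl
prodℤ-cong {suc k} f≗g = cong₂ ℤ._*_ (f≗g zero) (prodℤ-cong (λ i → f≗g (suc i)))

sumℤ-cong : ∀ {k} {f g : Fin k → ℤ} → (∀ i → f i ≡ g i) → sumℤ f ≡ sumℤ g
sumℤ-cong {zero}  _   = refl
sumℤ-cong {suc k} f≗g = cong₂ ℤ._+_ (f≗g zero) (sumℤ-cong (λ i → f≗g (suc i)))

Indicator : Set → ℕ → Set
Indicator A n = (A × n ≡ 1) ⊎ (¬ A × n ≡ 0)

Indicator-values : ∀ {A n} → Indicator A n → n ≡ 1 ⊎ n ≡ 0
Indicator-values (inj₁ (_ , n≡1)) = inj₁ n≡1
Indicator-values (inj₂ (_ , n≡0)) = inj₂ n≡0

Indicator-sound : ∀ {A n} → Indicator A n → n ≡ 1 → A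
Indicator-sound (inj₁ (a , _))   _   = a
Indicator-sound (inj₂ (_ , n≡0)) n≡1 with () ← trans (sym n≡1) n≡0

Indicator-complete : ∀ {A n} → Indicator A n → A → n ≡ 1
Indicator-complete (inj₁ (_ , n≡1)) _ = n≡1
Indicator-complete (inj₂ (¬a , _))  a = ⊥-elim (¬a a)

count-ones : ∀ {k} (f : Fin k → ℕ) → (∀ l → f l ≡ 1 ⊎ f l ≡ 0) → Count _≡_ (λ l → f l ≡ 1) (sumℕ f)
count-ones f f01 = subst (Count _≡_ _) count≡sum
  (count-⇔ (λ l → from-does-true (f l ℕP.≟ 1)) (λ l → dec-true (f l ℕP.≟ 1))
           (count-true (λ l → does (f l ℕP.≟ 1))))
  where
  count≡sum : countB (λ l → does (f l ℕP.≟ 1)) ≡ sumℕ f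
  count≡sum = trans (countB-sumℕ (λ l → does (f l ℕP.≟ 1))) (sumℕ-cong (λ l → bit-01 l (f01 l)))
    where
    bit-01 : ∀ l → f l ≡ 1 ⊎ f l ≡ 0 → bit (does (f l ℕP.≟ 1)) ≡ f l
    bit-01 l (inj₁ fl≡1) rewrite fl≡1 = refl
    bit-01 l (inj₂ fl≡0) rewrite fl≡0 = refl

-- Subsets with prescribed class counts

prodℕ-others-cong : ∀ {k} {f g : Fin k → ℕ} i₀ → (∀ i → i ≢ i₀ → f i ≡ g i) →
                    prodℕ (λ i → if does (i ≟ i₀) then 1 else f i) ≡ prodℕ (λ i → if does (i ≟ i₀) then 1 else g i)
prodℕ-others-cong {f = f} {g} i₀ f≗g = prodℕ-cong (λ i → pointwise i (i ≟ i₀))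
  where
  pointwise : ∀ i (i? : Dec (i ≡ i₀)) → (if does i? then 1 else f i) ≡ (if does i? then 1 else g i)
  pointwise i (yes _)   = refl
  pointwise i (no i≢i₀) = f≗g i i≢i₀

prodℕ-pascal : ∀ {u} (n t : Fin u → ℕ) i₀ s → t i₀ ≡ suc s →
               prodℕ (λ i → n i C (if does (i ≟ i₀) then s else t i)) + prodℕ (λ i → n i C t i)
               ≡ prodℕ (λ i → (bit (does (i₀ ≟ i)) + n i) C t i)
prodℕ-pascal n t i₀ s tᵢ₀≡1+s = begin
  prodℕ (λ i → n i C t′ i) + prodℕ (λ i → n i C t i)
    ≡⟨ cong₂ _+_ (prodℕ-extract (λ i → n i C t′ i) i₀) (prodℕ-extract (λ i → n i C t i) i₀) ⟩
  (n i₀ C t′ i₀) * rest (λ i → n i C t′ i) + (n i₀ C t i₀) * rest (λ i → n i C t i)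
    ≡⟨ cong₂ (λ a b → (n i₀ C t′ i₀) * a + (n i₀ C t i₀) * b)
             (rest′≡ t′-off) (rest′≡ (λ _ _ → refl)) ⟩
  (n i₀ C t′ i₀) * rest′ + (n i₀ C t i₀) * rest′
    ≡⟨ cong₂ (λ a b → (n i₀ C a) * rest′ + (n i₀ C b) * rest′) t′ᵢ₀≡s tᵢ₀≡1+s ⟩
  (n i₀ C s) * rest′ + (n i₀ C suc s) * rest′
    ≡⟨ ℕP.*-distribʳ-+ rest′ (n i₀ C s) (n i₀ C suc s) ⟨
  (n i₀ C s + n i₀ C suc s) * rest′
    ≡⟨ cong (_* rest′) (nCk+nC[k+1]≡[n+1]C[k+1] (n i₀) s) ⟩
  (suc (n i₀) C suc s) * rest′
    ≡⟨ cong₂ (λ a b → (a C b) * rest′) (cong (_+ n i₀) (cong bit (dec-true (i₀ ≟ i₀) refl))) tᵢ₀≡1+s ⟨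
  ((bit (does (i₀ ≟ i₀)) + n i₀) C t i₀) * rest′
    ≡⟨ prodℕ-extract (λ i → (bit (does (i₀ ≟ i)) + n i) C t i) i₀ ⟨
  prodℕ (λ i → (bit (does (i₀ ≟ i)) + n i) C t i)
    ∎
  where
  open ≡-Reasoning
  t′ : _ → ℕ
  t′ i = if does (i ≟ i₀) then s else t i
  rest : (_ → ℕ) → ℕ
  rest f = prodℕ (λ i → if does (i ≟ i₀) then 1 else f i)
  rest′ = rest (λ i → (bit (does (i₀ ≟ i)) + n i) C t i)
  t′-off : ∀ i → i ≢ i₀ → n i C t′ i ≡ n i C t i
  t′-off i i≢i₀ rewrite dec-false (i ≟ i₀) i≢i₀ = refl
  t′ᵢ₀≡s : t′ i₀ ≡ s
  t′ᵢ₀≡s rewrite dec-true (i₀ ≟ i₀) refl = refl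
  off : ∀ i → i ≢ i₀ → bit (does (i₀ ≟ i)) ≡ 0
  off i i≢i₀ rewrite dec-false (i₀ ≟ i) (λ i₀≡i → i≢i₀ (sym i₀≡i)) = refl
  rest′≡ : ∀ {f} → (∀ i → i ≢ i₀ → f i ≡ n i C t i) → rest f ≡ rest′
  rest′≡ f≡ = prodℕ-others-cong i₀ (λ i i≢i₀ →
    trans (f≡ i i≢i₀) (cong (λ a → (a + n i) C t i) (sym (off i i≢i₀))))

module _ {u : ℕ} where

  classCount : ∀ {r} → (Fin r → Fin u) → (Fin r → Bool) → Fin u → ℕ
  classCount class S i = countB (λ e → does (class e ≟ i) ∧ S e)

  classSize : ∀ {r} → (Fin r → Fin u) → Fin u → ℕ
  classSize class i = countB (λ e → does (class e ≟ i))

  HasClassCounts : ∀ {r} → (Fin r → Fin u) → (Fin u → ℕ) → (Fin r → Bool) → Set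
  HasClassCounts class t S = ∀ i → classCount class S i ≡ t i

  HasClassCounts-resp : ∀ {r} (class : Fin r → Fin u) t {S S′} → S ≗ S′ →
                        HasClassCounts class t S → HasClassCounts class t S′
  HasClassCounts-resp class t S≗S′ has i =
    trans (countB-cong (λ e → cong (does (class e ≟ i) ∧_) (sym (S≗S′ e)))) (has i)

  module _ {r} (class : Fin (suc r) → Fin u) (t : Fin u → ℕ) where
    private
      i₀ = class zero
      class′ : Fin r → Fin u
      class′ e = class (suc e)

    classCount-suc : ∀ S i →
                     classCount class S i ≡ bit (does (i₀ ≟ i) ∧ S zero) + classCount class′ (λ e → S (suc e)) i
    classCount-suc S i = countB-suc (λ e → does (class e ≟ i) ∧ S e)

    classCount-first-false : ∀ S → S zero ≡ false → ∀ i →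
                             classCount class S i ≡ classCount class′ (λ e → S (suc e)) i
    classCount-first-false S S₀ i rewrite classCount-suc S i | S₀ | BoolP.∧-zeroʳ (does (i₀ ≟ i)) = refl

    classCount-first-true : ∀ S → S zero ≡ true → ∀ i →
                            classCount class S i ≡ bit (does (i₀ ≟ i)) + classCount class′ (λ e → S (suc e)) i
    classCount-first-true S S₀ i rewrite classCount-suc S i | S₀ | BoolP.∧-identityʳ (does (i₀ ≟ i)) = refl

    classSize-suc : ∀ i → classSize class i ≡ bit (does (i₀ ≟ i)) + classSize class′ i
    classSize-suc i = countB-suc (λ e → does (class e ≟ i))

    count-without-first : ∀ {n} → Count _≗_ (HasClassCounts class′ t) n →
                          Count _≗_ (λ S → HasClassCounts class t S × ¬ S zero ≡ true) n
    count-without-first K = count-image K (false Vector.∷_)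
      (λ S has → (λ i → trans (classCount-first-false (false Vector.∷ S) refl i) (has i)) , λ ())
      (λ _ _ _ _ same e → same (suc e))
      (λ S (has , S₀≢true) → (λ e → S (suc e)) ,
        (λ i → trans (sym (classCount-first-false S (BoolP.¬-not S₀≢true) i)) (has i)) ,
        λ { _ S′≗ zero → sym (BoolP.¬-not S₀≢true) ; _ S′≗ (suc e) → S′≗ e })

    count-with-first-none : t i₀ ≡ 0 → Count _≗_ (λ S → HasClassCounts class t S × S zero ≡ true) 0
    count-with-first-none tᵢ₀≡0 = count-none λ S (has , S₀) → contradiction S (trans (has i₀) tᵢ₀≡0) S₀
      where
      contradiction : ∀ S → classCount class S i₀ ≡ 0 → ¬ S zero ≡ true
      contradiction S none S₀ rewrite classCount-suc S i₀ | S₀ | dec-true (i₀ ≟ i₀) refl with () ← none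

    module _ (s : ℕ) (tᵢ₀≡1+s : t i₀ ≡ suc s) where
      t∖first : Fin u → ℕ
      t∖first i = if does (i ≟ i₀) then s else t i

      t-split : ∀ i → bit (does (i₀ ≟ i)) + t∖first i ≡ t i
      t-split i with i ≟ i₀
      ... | yes refl rewrite dec-true (i ≟ i) refl = sym tᵢ₀≡1+s
      ... | no i≢i₀  rewrite dec-false (i₀ ≟ i) (λ i₀≡i → i≢i₀ (sym i₀≡i)) = refl

      count-with-first : ∀ {n} → Count _≗_ (HasClassCounts class′ t∖first) n →
                         Count _≗_ (λ S → HasClassCounts class t S × S zero ≡ true) n
      count-with-first K = count-image K (true Vector.∷_)
        (λ S has → (λ i → trans (classCount-first-true (true Vector.∷ S) refl i)
                            (trans (cong (bit (does (i₀ ≟ i)) +_) (has i)) (t-split i))) , refl)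
        (λ _ _ _ _ same e → same (suc e))
        (λ S (has , S₀) → (λ e → S (suc e)) ,
          (λ i → ℕP.+-cancelˡ-≡ (bit (does (i₀ ≟ i))) _ _
                   (trans (sym (classCount-first-true S S₀ i)) (trans (has i) (sym (t-split i))))) ,
          λ { _ S′≗ zero → sym S₀ ; _ S′≗ (suc e) → S′≗ e })

  count-by-first : ∀ {r} {P : (Fin (suc r) → Bool) → Set} {n₁ n₂} →
                   Count _≗_ (λ S → P S × S zero ≡ true) n₁ → Count _≗_ (λ S → P S × ¬ S zero ≡ true) n₂ →
                   Count _≗_ P (n₁ + n₂)
  count-by-first =
    count-+ (λ S≗ e → sym (S≗ e)) (λ S≗ S₀ → trans (sym (S≗ zero)) S₀) (λ S → S zero BoolP.≟ true)

  -- Pascal's rule: a subset either omits or contains the first element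
  count-classCounts : ∀ {r} (class : Fin r → Fin u) (t : Fin u → ℕ) →
                      Count _≗_ (HasClassCounts class t) (prodℕ (λ i → classSize class i C t i))
  count-classCounts {zero} class t with FinP.all? (λ i → t i ℕP.≟ 0)
  ... | yes t≡0 = subst (Count _≗_ _) (sym (prodℕ-ones _ (λ i → cong (0 C_) (t≡0 i)))) (record
    { elem = λ _ () ; valid = λ _ i → sym (t≡0 i) ; distinct = λ { zero zero _ → refl }
    ; complete = λ _ _ → zero , λ () })
  ... | no t≢0 with (i , tᵢ≢0) ← FinP.¬∀⟶∃¬ u _ (λ i → t i ℕP.≟ 0) t≢0 =
    subst (Count _≗_ _) (sym (prodℕ-zero _ i (k>n⇒nCk≡0 (ℕP.n≢0⇒n>0 tᵢ≢0))))
          (count-none (λ S has → tᵢ≢0 (sym (has i))))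
  count-classCounts {suc r} class t with t (class zero) in tᵢ₀
  ... | zero  = subst (Count _≗_ _) (prodℕ-cong size-eq)
                  (count-by-first (count-with-first-none class t tᵢ₀)
                                  (count-without-first class t (count-classCounts (λ e → class (suc e)) t)))
    where
    size-eq : ∀ i → classSize (λ e → class (suc e)) i C t i ≡ classSize class i C t i
    size-eq i with i ≟ class zero
    ... | yes refl rewrite tᵢ₀ = refl
    ... | no i≢i₀  rewrite classSize-suc class t i | dec-false (class zero ≟ i) (λ i₀≡i → i≢i₀ (sym i₀≡i)) = refl
  ... | suc s = subst (Count _≗_ _) (trans (prodℕ-pascal (classSize (λ e → class (suc e))) t (class zero) s tᵢ₀)
                                          (prodℕ-cong (λ i → cong (_C t i) (sym (classSize-suc class t i)))))
                  (count-by-first (count-with-first class t s tᵢ₀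
                                     (count-classCounts (λ e → class (suc e)) (t∖first class t s tᵢ₀)))
                                  (count-without-first class t (count-classCounts (λ e → class (suc e)) t)))

  prodℕ-by-class : ∀ {r} (class : Fin r → Fin u) (S : Fin r → Bool) (f g : Fin u → ℕ) →
                   prodℕ (λ e → if S e then f (class e) else g (class e))
                   ≡ prodℕ (λ i → f i ^ classCount class S i * g i ^ classCount class (λ e → not (S e)) i)
  prodℕ-by-class class S f g = begin
    prodℕ (λ e → if S e then f (class e) else g (class e))
      ≡⟨ prodℕ-cong (λ e → choose-if (S e) (class e)) ⟩
    prodℕ (λ e → choose (class e) (side (S e)))
      ≡⟨ prodℕ-regroup choose class (λ e → side (S e)) ⟩
    prodℕ (λ i → prodℕ (λ k → choose i k ^ countB (λ e → does (i ≟ class e) ∧ does (k ≟ side (S e)))))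
      ≡⟨ prodℕ-cong (λ i → cong₂ _*_ (cong (f i ^_) (counts i true))
                                     (trans (ℕP.*-identityʳ _) (cong (g i ^_) (counts i false)))) ⟩
    prodℕ (λ i → f i ^ classCount class S i * g i ^ classCount class (λ e → not (S e)) i)
      ∎
    where
    open ≡-Reasoning
    side : Bool → Fin 2
    side true  = zero
    side false = suc zero
    choose : Fin u → Fin 2 → ℕ
    choose i zero    = f i
    choose i (suc _) = g i
    choose-if : ∀ s i → (if s then f i else g i) ≡ choose i (side s)
    choose-if true  i = refl
    choose-if false i = refl
    side-≟ : ∀ s s′ → does (side s′ ≟ side s) ≡ (if s′ then s else not s)
    side-≟ true  true  = refl
    side-≟ true  false = refl
    side-≟ false true  = refl
    side-≟ false false = refl
    counts : ∀ i s′ → countB (λ e → does (i ≟ class e) ∧ does (side s′ ≟ side (S e)))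
                      ≡ classCount class (λ e → if s′ then S e else not (S e)) i
    counts i s′ = countB-cong (λ e → cong₂ _∧_ (does-sym i (class e)) (side-≟ (S e) s′))

module _ (V : Vocab) where
  open Vocab V

  record Induced {k n} (S′ : Str V k) (S : Str V n) (h : Fin k → Fin n) : Set where
    field
      un-≡ : ∀ P z → Str.un S′ P z ≡ Str.un S P (h z)
      bi-≡ : ∀ Q z z′ → Str.bi S′ Q z z′ ≡ Str.bi S Q (h z) (h z′)
  open Induced

  ⟦⟧-induced : ∀ {k n} {S′ : Str V k} {S : Str V n} {h : Fin k → Fin n} →
               (∀ {a b} → h a ≡ h b → a ≡ b) → Induced S′ S h →
               ∀ ψ {ρ ρ′} → (∀ v → h (ρ v) ≡ ρ′ v) → ⟦_⟧ V ψ S′ ρ ⇔ ⟦_⟧ V ψ S ρ′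
  ⟦⟧-induced h-inj I tt _ = ⇔.refl
  ⟦⟧-induced h-inj I ff _ = ⇔.refl
  ⟦⟧-induced {S = S} h-inj I (un P v) {ρ} hρ = mk⇔ (trans (sym same)) (trans same)
    where same = trans (un-≡ I P (ρ v)) (cong (Str.un S P) (hρ v))
  ⟦⟧-induced {S = S} h-inj I (bi Q v w) {ρ} hρ = mk⇔ (trans (sym same)) (trans same)
    where same = trans (bi-≡ I Q (ρ v) (ρ w)) (cong₂ (Str.bi S Q) (hρ v) (hρ w))
  ⟦⟧-induced {h = h} h-inj I (eq v w) hρ =
    mk⇔ (λ p → trans (sym (hρ v)) (trans (cong h p) (hρ w))) (λ p → h-inj (trans (hρ v) (trans p (sym (hρ w)))))
  ⟦⟧-induced h-inj I (neg ψ)   hρ = ¬-cong-⇔ (⟦⟧-induced h-inj I ψ hρ)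
  ⟦⟧-induced h-inj I (ψ and χ) hρ = ⟦⟧-induced h-inj I ψ hρ ×-⇔ ⟦⟧-induced h-inj I χ hρ
  ⟦⟧-induced h-inj I (ψ or χ)  hρ = ⟦⟧-induced h-inj I ψ hρ ⊎-⇔ ⟦⟧-induced h-inj I χ hρ

  tp-induced : ∀ {k n} {S′ : Str V k} {S : Str V n} {h : Fin k → Fin n} → Induced S′ S h →
               ∀ c → tp V S (h c) ≡ tp V S′ c
  tp-induced I c = cong₂ _,_ (VecP.tabulate-cong (λ P → sym (un-≡ I P c)))
                             (VecP.tabulate-cong (λ Q → sym (bi-≡ I Q c c)))

  ⟦⟧-env : ∀ {n} (S : Str V n) ψ {ρ ρ′ : Var V → Fin n} → (∀ v → ρ v ≡ ρ′ v) →
           ⟦_⟧ V ψ S ρ ⇔ ⟦_⟧ V ψ S ρ′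
  ⟦⟧-env S = ⟦⟧-induced (λ same → same) (record { un-≡ = λ _ _ → refl ; bi-≡ = λ _ _ _ → refl })

  ⟦⟧-sub : ∀ {n} (S : Str V n) ψ σ (ρ : Var V → Fin n) →
           ⟦_⟧ V (sub V ψ σ) S ρ ⇔ ⟦_⟧ V ψ S (λ v → ρ (σ v))
  ⟦⟧-sub S tt         σ ρ = ⇔.refl
  ⟦⟧-sub S ff         σ ρ = ⇔.refl
  ⟦⟧-sub S (un P v)   σ ρ = ⇔.refl
  ⟦⟧-sub S (bi Q v w) σ ρ = ⇔.refl
  ⟦⟧-sub S (eq v w)   σ ρ = ⇔.refl
  ⟦⟧-sub S (neg ψ)    σ ρ = ¬-cong-⇔ (⟦⟧-sub S ψ σ ρ)
  ⟦⟧-sub S (ψ and χ)  σ ρ = ⟦⟧-sub S ψ σ ρ ×-⇔ ⟦⟧-sub S χ σ ρ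
  ⟦⟧-sub S (ψ or χ)   σ ρ = ⟦⟧-sub S ψ σ ρ ⊎-⇔ ⟦⟧-sub S χ σ ρ

  ⟦⟧-instance : ∀ {n} (S : Str V n) ψ a b (c e : Fin n) →
                ⟦_⟧ V (_⟨_,_⟩ V ψ a b) S (env V c e) ⇔ ⟦_⟧ V ψ S (env V (env V c e a) (env V c e b))
  ⟦⟧-instance S ψ a b c e = ⇔.trans (⟦⟧-sub S ψ _ (env V c e)) (⟦⟧-env S ψ (λ { vx → refl ; vy → refl }))

  pairForm-intro : ∀ {n} (S : Str V n) ψ (c e : Fin n) → c ≢ e →
                   ⟦_⟧ V ψ S (env V c c) → ⟦_⟧ V ψ S (env V c e) →
                   ⟦_⟧ V ψ S (env V e c) → ⟦_⟧ V ψ S (env V e e) →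
                   ⟦_⟧ V (pairForm V ψ) S (env V c e)
  pairForm-intro S ψ c e c≢e ψcc ψce ψec ψee =
    Equivalence.from (⟦⟧-instance S ψ vx vx c e) ψcc , Equivalence.from (⟦⟧-instance S ψ vx vy c e) ψce ,
    Equivalence.from (⟦⟧-instance S ψ vy vx c e) ψec , Equivalence.from (⟦⟧-instance S ψ vy vy c e) ψee , c≢e

  pairForm-elim : ∀ {n} (S : Str V n) ψ (c e : Fin n) → ⟦_⟧ V (pairForm V ψ) S (env V c e) →
                  ⟦_⟧ V ψ S (env V c e) × ⟦_⟧ V ψ S (env V e c)
  pairForm-elim S ψ c e (_ , ψce , ψec , _) =
    Equivalence.to (⟦⟧-instance S ψ vx vy c e) ψce , Equivalence.to (⟦⟧-instance S ψ vy vx c e) ψec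

  pick : ∀ {n} → Fin n → Fin n → Fin 2 → Fin n
  pick a b zero    = a
  pick a b (suc _) = b

  pick-injective : ∀ {n} {a b : Fin n} → a ≢ b → ∀ {x y} → pick a b x ≡ pick a b y → x ≡ y
  pick-injective a≢b {zero}     {zero}     _    = refl
  pick-injective a≢b {zero}     {suc zero} same = ⊥-elim (a≢b same)
  pick-injective a≢b {suc zero} {zero}     same = ⊥-elim (a≢b (sym same))
  pick-injective a≢b {suc zero} {suc zero} _    = refl

  env-∘ : ∀ {k n} (f : Fin k → Fin n) c c′ v → f (env V c c′ v) ≡ env V (f c) (f c′) v
  env-∘ f c c′ vx = refl
  env-∘ f c c′ vy = refl

  restrict₂ : ∀ {n} → Str V n → Fin n → Fin n → Str V 2
  restrict₂ S a b = record
    { un = λ P z → Str.un S P (pick a b z) ; bi = λ Q z z′ → Str.bi S Q (pick a b z) (pick a b z′) }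

  Ent2-apply : ∀ {n} (S : Str V n) (a b : Fin n) → a ≢ b → ∀ {ti tj tl} χ →
               tp V S a ≡ ti → tp V S b ≡ tj → tb V S a b ≡ tl → Ent2 V ti tj tl χ → ⟦_⟧ V χ S (env V a b)
  Ent2-apply S a b a≢b χ tpa tpb tbab entails =
    Equivalence.to (⟦⟧-induced (pick-injective a≢b) (record { un-≡ = λ _ _ → refl ; bi-≡ = λ _ _ _ → refl })
                                χ (env-∘ (pick a b) (x0 V) (y1 V)))
      (entails (restrict₂ S a b) tpa tpb tbab)

  -- any two-element structure with the types of a and b is induced from S by pick a b
  Ent2-intro : ∀ {n} (S : Str V n) (a b : Fin n) → a ≢ b → ∀ {ti tj tl} χ →
               tp V S a ≡ ti → tp V S b ≡ tj → tb V S a b ≡ tl → ⟦_⟧ V χ S (env V a b) → Ent2 V ti tj tl χ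
  Ent2-intro S a b a≢b χ tpa tpb tbab χab S₂ tp₀ tp₁ tb₀₁ =
    Equivalence.from (⟦⟧-induced (pick-injective a≢b) induced χ (env-∘ (pick a b) (x0 V) (y1 V))) χab
    where
    same : ∀ {k} {f g : Fin k → Bool} {v} → tabulate f ≡ v → tabulate g ≡ v → ∀ i → f i ≡ g i
    same {f = f} {g} tf tg i = trans (lookup-tabulate-≡ f tf i) (sym (lookup-tabulate-≡ g tg i))
    induced : Induced S₂ S (pick a b)
    induced = record { un-≡ = un-≡′ ; bi-≡ = bi-≡′ }
      where
      un-≡′ : ∀ P z → Str.un S₂ P z ≡ Str.un S P (pick a b z)
      un-≡′ P zero       = same (cong proj₁ tp₀) (cong proj₁ tpa) P
      un-≡′ P (suc zero) = same (cong proj₁ tp₁) (cong proj₁ tpb) P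
      bi-≡′ : ∀ Q z z′ → Str.bi S₂ Q z z′ ≡ Str.bi S Q (pick a b z) (pick a b z′)
      bi-≡′ Q zero       zero       = same (cong proj₂ tp₀) (cong proj₂ tpa) Q
      bi-≡′ Q (suc zero) (suc zero) = same (cong proj₂ tp₁) (cong proj₂ tpb) Q
      bi-≡′ Q zero       (suc zero) = same (cong proj₁ tb₀₁) (cong proj₁ tbab) Q
      bi-≡′ Q (suc zero) zero       = same (cong proj₂ tb₀₁) (cong proj₂ tbab) Q

  canonical₂ : OneType V → OneType V → TwoTable V → Str V 2
  canonical₂ (uᵢ , bᵢ) (uⱼ , bⱼ) (bₓᵧ , bᵧₓ) = record { un = un′ ; bi = bi′ }
    where
    un′ : Fin p → Fin 2 → Bool
    un′ P zero    = lookup uᵢ P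
    un′ P (suc _) = lookup uⱼ P
    bi′ : Fin q → Fin 2 → Fin 2 → Bool
    bi′ Q zero    zero    = lookup bᵢ Q
    bi′ Q zero    (suc _) = lookup bₓᵧ Q
    bi′ Q (suc _) zero    = lookup bᵧₓ Q
    bi′ Q (suc _) (suc _) = lookup bⱼ Q

  Ent2-canonical : ∀ ti tj tl χ → Ent2 V ti tj tl χ → ⟦_⟧ V χ (canonical₂ ti tj tl) (env V (x0 V) (y1 V))
  Ent2-canonical ti tj tl χ entails = entails (canonical₂ ti tj tl) (tab∘lookup ti) (tab∘lookup tj) (tab∘lookup tl)
    where
    tab∘lookup : ∀ {k l} (t : Vec Bool k × Vec Bool l) → (tabulate (lookup (proj₁ t)) , tabulate (lookup (proj₂ t))) ≡ t
    tab∘lookup (v , w) = cong₂ _,_ (VecP.tabulate∘lookup v) (VecP.tabulate∘lookup w)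

-- Extending ω″ by sinks

module Extension
  (V : Vocab) (φ : QF V) {u : ℕ} (e1 : Fin u ↔ OneType V) {b : ℕ} (e2 : Fin b ↔ TwoTable V)
  (d : ℕ) {τ : ℕ} (enumT : Fin τ → Vec ℕ u) (enumT-injective : Injective _≡_ _≡_ enumT)
  (T-bounded : ∀ t → (Vec.sum t ≤ d) ⇔ Σ (Fin τ) (λ k → enumT k ≡ t))
  (cs ds : Fin u → Fin u → Fin b → ℕ)
  (cs-spec : ∀ i j l → Indicator (Ent2 V (Inverse.to e1 i) (Inverse.to e1 j) (Inverse.to e2 l)
                                   (pairForm V φ and (bi (Vocab.R V) vx vy and neg (bi (Vocab.R V) vy vx))))
                                 (cs i j l))
  (ds-spec : ∀ i j l → Indicator (Ent2 V (Inverse.to e1 i) (Inverse.to e1 j) (Inverse.to e2 l)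
                                   (pairForm V φ and (neg (bi (Vocab.R V) vx vy) and neg (bi (Vocab.R V) vy vx))))
                                 (ds i j l))
  {m r : ℕ}
  (ω′ : Interp V τ m)
  (sat′ : Ctx.SatAll V e1 enumT d (φ and neg (bi (Vocab.R V) vx vy)) ω′)
  (label′-unique : ∀ c → Σ (Fin τ) (λ k → (Interp.A ω′ k c ≡ true)
                                        × (∀ k′ → Interp.A ω′ k′ c ≡ true → k′ ≡ k)))
  (ω″ : Interp V τ r)
  (sat″ : Ctx.SatAll V e1 enumT d φ ω″)
  (dag″ : Ctx.EssentialDAG V e1 enumT d ω″)
  (condC″ : Ctx.CondC V e1 enumT d ω″)
  where

  open Vocab V using (R)
  open Ctx V e1 enumT d

  private
    to1 = Inverse.to e1
    from1 = Inverse.from e1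
    to2 = Inverse.to e2
    from2 = Inverse.from e2
    S′ = Interp.str ω′
    S″ = Interp.str ω″

  χ→ χ∅ : QF V
  χ→ = pairForm V φ and (bi R vx vy and neg (bi R vy vx))
  χ∅ = pairForm V φ and (neg (bi R vx vy) and neg (bi R vy vx))

  acyclic″ : ∀ c → ¬ TransClosure (Edge ω″) c c
  acyclic″ = proj₁ dag″

  ι′ : Fin m → Fin (m + r)
  ι′ c = c ↑ˡ r

  ι″ : Fin r → Fin (m + r)
  ι″ e = m ↑ʳ e

  data Side : Fin (m + r) → Set where
    new : ∀ c → Side (ι′ c)
    old : ∀ e → Side (ι″ e)

  side : ∀ x → Side x
  side x with splitAt m x in split≡
  ... | inj₁ c = subst Side (FinP.splitAt⁻¹-↑ˡ split≡) (new c)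
  ... | inj₂ e = subst Side (FinP.splitAt⁻¹-↑ʳ split≡) (old e)

  ι′≢ι″ : ∀ c e → ι′ c ≢ ι″ e
  ι′≢ι″ c e same with () ← trans (sym (FinP.splitAt-↑ˡ m c r)) (trans (cong (splitAt m) same) (FinP.splitAt-↑ʳ m r e))

  ι″≢ι′ : ∀ e c → ι″ e ≢ ι′ c
  ι″≢ι′ e c same = ι′≢ι″ c e (sym same)

  ι′-injective : ∀ {c c′} → ι′ c ≡ ι′ c′ → c ≡ c′
  ι′-injective = FinP.↑ˡ-injective r _ _

  ι″-injective : ∀ {e e′} → ι″ e ≡ ι″ e′ → e ≡ e′
  ι″-injective = FinP.↑ʳ-injective m _ _

  count-parents-of-sinks : ∀ (ω : Interp V τ (m + r)) → (∀ c y → Rb ω (ι′ c) y ≡ false) →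
                           ∀ (X : Fin (m + r) → Bool) y →
                           countB (λ x → X x ∧ Rb ω x y) ≡ countB (λ e → X (ι″ e) ∧ Rb ω (ι″ e) y)
  count-parents-of-sinks ω sinks X y = trans (countB-splitAt m (λ x → X x ∧ Rb ω x y))
    (cong (_+ countB (λ e → X (ι″ e) ∧ Rb ω (ι″ e) y))
      (countB-none _ (λ c → trans (cong (X (ι′ c) ∧_) (sinks c y)) (BoolP.∧-zeroʳ _))))

  family-ι″ : ∀ (ω : Interp V τ (m + r)) → (∀ e a → Rb ω (ι″ e) (ι″ a) ≡ Rb ω″ e a) →
              ∀ e a → (Edge ω (ι″ e) (ι″ a) ⊎ ι″ e ≡ ι″ a) ⇔ (Edge ω″ e a ⊎ e ≡ a)
  family-ι″ ω R≡ e a = mk⇔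
    (λ { (inj₁ edge) → inj₁ (trans (sym (R≡ e a)) edge) ; (inj₂ same) → inj₂ (ι″-injective same) })
    (λ { (inj₁ edge) → inj₁ (trans (R≡ e a) edge) ; (inj₂ refl) → inj₂ refl })

  type : ∀ {n} → Str V n → Fin n → Fin u
  type S c = from1 (tp V S c)

  tp-type : ∀ {n} (S : Str V n) c → to1 (type S c) ≡ tp V S c
  tp-type S c = Inverse.strictlyInverseˡ e1 (tp V S c)

  realizes-type : ∀ {n} (S : Str V n) c i → realizes S c i ≡ does (type S c ≟ i)
  realizes-type S c i with _≟T_ V (tp V S c) (to1 i) | type S c ≟ i
  ... | yes tp≡ | yes _     = refl
  ... | yes tp≡ | no type≢  = ⊥-elim (type≢ (trans (cong from1 tp≡) (Inverse.strictlyInverseʳ e1 i)))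
  ... | no tp≢  | yes type≡ = ⊥-elim (tp≢ (trans (sym (tp-type S c)) (cong to1 type≡)))
  ... | no _    | no _      = refl

  realizes-cong : ∀ {n n′} {S : Str V n} {S′ : Str V n′} {c c′ i} → tp V S c ≡ tp V S′ c′ →
                  realizes S c i ≡ realizes S′ c′ i
  realizes-cong {i = i} same = cong (λ tp → does (_≟T_ V tp (to1 i))) same

  countB-realizes : ∀ {n} (S : Str V n) (X : Fin n → Bool) i →
                    countB (λ x → realizes S x i ∧ X x) ≡ classCount (type S) X i
  countB-realizes S X i = countB-cong (λ x → cong (_∧ X x) (realizes-type S x i))

  type′ : Fin m → Fin u
  type′ = type S′

  type″ : Fin r → Fin u
  type″ = type S″

  label′ : Fin m → Fin τ
  label′ c = proj₁ (label′-unique c)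

  induced-ι′ : ∀ (ω : Interp V τ (m + r)) → _≈I_ V (restrL V m r ω) ω′ → Induced V S′ (Interp.str ω) ι′
  induced-ι′ ω (un≡ , bi≡ , _) = record { un-≡ = λ P c → sym (un≡ P c) ; bi-≡ = λ Q c c′ → sym (bi≡ Q c c′) }

  induced-ι″ : ∀ (ω : Interp V τ (m + r)) → _≈I_ V (restrR V m r ω) ω″ → Induced V S″ (Interp.str ω) ι″
  induced-ι″ ω (un≡ , bi≡ , _) = record { un-≡ = λ P e → sym (un≡ P e) ; bi-≡ = λ Q e e′ → sym (bi≡ Q e e′) }

  tp-type-ι′ : ∀ (ω : Interp V τ (m + r)) → _≈I_ V (restrL V m r ω) ω′ →
               ∀ c → tp V (Interp.str ω) (ι′ c) ≡ to1 (type′ c)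
  tp-type-ι′ ω ω↓′ c = trans (tp-induced V (induced-ι′ ω ω↓′) c) (sym (tp-type S′ c))

  tp-type-ι″ : ∀ (ω : Interp V τ (m + r)) → _≈I_ V (restrR V m r ω) ω″ →
               ∀ e → tp V (Interp.str ω) (ι″ e) ≡ to1 (type″ e)
  tp-type-ι″ ω ω↓″ e = trans (tp-induced V (induced-ι″ ω ω↓″) e) (sym (tp-type S″ e))

  -- R(x, y) in the 2-table l of an (old, new) pair: whether the old element is a parent of the new one
  Rxy : Fin b → Bool
  Rxy l = lookup (proj₁ (to2 l)) R

  Admissible : Bool → Fin u → Fin u → Fin b → Set
  Admissible true  i j l = cs i j l ≡ 1
  Admissible false i j l = ds i j l ≡ 1

  admissibleCount : Bool → Fin u → Fin u → ℕ
  admissibleCount true  i j = sumℕ (cs i j)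
  admissibleCount false i j = sumℕ (ds i j)

  Admissible-Ent2 : ∀ s i j l → Admissible s i j l → Ent2 V (to1 i) (to1 j) (to2 l) (if s then χ→ else χ∅)
  Admissible-Ent2 true  i j l = Indicator-sound (cs-spec i j l)
  Admissible-Ent2 false i j l = Indicator-sound (ds-spec i j l)

  Admissible-Rxy : ∀ s i j l → Admissible s i j l → Rxy l ≡ s
  Admissible-Rxy true i j l adm =
    proj₁ (proj₂ (Ent2-canonical V (to1 i) (to1 j) (to2 l) χ→ (Admissible-Ent2 true i j l adm)))
  Admissible-Rxy false i j l adm =
    BoolP.¬-not (proj₁ (proj₂ (Ent2-canonical V (to1 i) (to1 j) (to2 l) χ∅ (Admissible-Ent2 false i j l adm))))

  count-Admissible : ∀ s i j → Count _≡_ (Admissible s i j) (admissibleCount s i j)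
  count-Admissible true  i j = count-ones (cs i j) (λ l → Indicator-values (cs-spec i j l))
  count-Admissible false i j = count-ones (ds i j) (λ l → Indicator-values (ds-spec i j l))

  _≟V_ : (v w : Vec ℕ u) → Dec (v ≡ w)
  _≟V_ = VecP.≡-dec ℕP._≟_

  hasExt-label : ∀ {n} (ω : Interp V τ n) c (ℓ : Fin τ) → (∀ k → Interp.A ω k c ≡ true ⇔ k ≡ ℓ) →
                 ∀ i k → hasExt ω c i (enumT k) ≡ does (i ≟ type (Interp.str ω) c) ∧ does (k ≟ ℓ)
  hasExt-label ω c ℓ A⇔ℓ i k =
    cong₂ _∧_ (trans (realizes-type (Interp.str ω) c i) (does-sym _ i)) (BoolP.⇔→≡ {z = true} (mk⇔ to from))
    where
    to : allB (λ k′ → does (Interp.A ω k′ c BoolP.≟ does (enumT k′ ≟V enumT k))) ≡ true → does (k ≟ ℓ) ≡ true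
    to all-agree = dec-true (k ≟ ℓ) (sym (enumT-injective
      (from-does-true (enumT ℓ ≟V enumT k)
        (trans (sym (from-does-true (_ BoolP.≟ _) (Equivalence.to (allB-true _) all-agree ℓ)))
               (Equivalence.from (A⇔ℓ ℓ) refl)))))
    from : does (k ≟ ℓ) ≡ true → allB (λ k′ → does (Interp.A ω k′ c BoolP.≟ does (enumT k′ ≟V enumT k))) ≡ true
    from k≟ℓ = Equivalence.from (allB-true _) (λ k′ → dec-true (_ BoolP.≟ _) (BoolP.⇔→≡ {z = true} (mk⇔
      (λ A → dec-true (enumT k′ ≟V enumT k) (cong enumT (trans (Equivalence.to (A⇔ℓ k′) A) (sym k≡ℓ))))
      (λ same → Equivalence.from (A⇔ℓ k′)
                  (trans (enumT-injective (from-does-true (enumT k′ ≟V enumT k) same)) k≡ℓ)))))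
      where k≡ℓ = from-does-true (k ≟ ℓ) k≟ℓ

  A′⇔label′ : ∀ c k → Interp.A ω′ k c ≡ true ⇔ k ≡ label′ c
  A′⇔label′ c k = mk⇔ (proj₂ (proj₂ (label′-unique c)) k) (λ { refl → proj₁ (proj₂ (label′-unique c)) })

  parents″ : Fin r → Vec ℕ u
  parents″ a = tabulate (λ i → countB (λ x → realizes S″ x i ∧ Rb ω″ x a))

  lookup-parents″ : ∀ a i → lookup (parents″ a) i ≡ classCount type″ (λ x → Rb ω″ x a) i
  lookup-parents″ a i = trans (VecP.lookup∘tabulate _ i) (countB-realizes S″ (λ x → Rb ω″ x a) i)

  sum-parents″ : ∀ a → Vec.sum (parents″ a) ≡ countB (λ x → Rb ω″ x a)
  sum-parents″ a = begin
    Vec.sum (parents″ a)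
      ≡⟨ sum-tabulate (λ i → countB (λ x → realizes S″ x i ∧ Rb ω″ x a)) ⟩
    sumℕ (λ i → countB (λ x → realizes S″ x i ∧ Rb ω″ x a))
      ≡⟨ sumℕ-cong (countB-realizes S″ (λ x → Rb ω″ x a)) ⟩
    sumℕ (λ i → classCount type″ (λ x → Rb ω″ x a) i)
      ≡⟨ countB-by-class type″ (λ x → Rb ω″ x a) ⟨
    countB (λ x → Rb ω″ x a)
      ∎
    where open ≡-Reasoning

  A″⇔parents″ : ∀ k a → Interp.A ω″ k a ≡ true ⇔ parents″ a ≡ enumT k
  A″⇔parents″ k a = mk⇔
    (λ A → lookup-extensionality (λ i → trans (VecP.lookup∘tabulate _ i) (Equivalence.to (condC″ a k) A i)))
    (λ parents≡ → Equivalence.from (condC″ a k)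
                    (λ i → trans (sym (VecP.lookup∘tabulate _ i)) (cong (λ v → lookup v i) parents≡)))

  -- the in-degree bound of ω″ puts every parent vector into T
  label″-spec : ∀ a → Σ (Fin τ) (λ k → enumT k ≡ parents″ a)
  label″-spec a = Equivalence.to (T-bounded (parents″ a)) (subst (_≤ d) (sym (sum-parents″ a)) (proj₂ (proj₂ dag″) a))

  label″ : Fin r → Fin τ
  label″ a = proj₁ (label″-spec a)

  A″⇔label″ : ∀ a k → Interp.A ω″ k a ≡ true ⇔ k ≡ label″ a
  A″⇔label″ a k = ⇔.trans (A″⇔parents″ k a)
    (mk⇔ (λ parents≡ → enumT-injective (trans (sym parents≡) (sym (proj₂ (label″-spec a)))))
         (λ { refl → sym (proj₂ (label″-spec a)) }))

  hasExt″ : ∀ a i t → hasExt ω″ a i t ≡ true ⇔ (type″ a ≡ i × parents″ a ≡ t)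
  hasExt″ a i t = mk⇔ to from
    where
    A″-agrees : hasExt ω″ a i t ≡ true → ∀ k → Interp.A ω″ k a ≡ does (enumT k ≟V t)
    A″-agrees ext k = from-does-true (_ BoolP.≟ _) (Equivalence.to (allB-true _) (proj₂ (∧-true ext)) k)
    to : hasExt ω″ a i t ≡ true → type″ a ≡ i × parents″ a ≡ t
    to ext = from-does-true (type″ a ≟ i) (trans (sym (realizes-type S″ a i)) (proj₁ (∧-true ext))) ,
             trans (sym (proj₂ (label″-spec a)))
               (from-does-true (_ ≟V t) (trans (sym (A″-agrees ext (label″ a))) (Equivalence.from (A″⇔label″ a _) refl)))
    from : type″ a ≡ i × parents″ a ≡ t → hasExt ω″ a i t ≡ true
    from (type≡i , parents≡t) = cong₂ _∧_ (trans (realizes-type S″ a i) (dec-true (type″ a ≟ i) type≡i))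
      (Equivalence.from (allB-true _) (λ k → dec-true (_ BoolP.≟ _) (BoolP.⇔→≡ {z = true} (mk⇔
        (λ A → dec-true (enumT k ≟V t) (trans (sym (Equivalence.to (A″⇔parents″ k a) A)) parents≡t))
        (λ same → Equivalence.from (A″⇔parents″ k a) (trans parents≡t (sym (from-does-true (enumT k ≟V t) same))))))))

  classSize-type″ : ∀ i → sumℕ (λ k → kext ω″ i (enumT k)) ≡ classSize type″ i
  classSize-type″ i = begin
    sumℕ (λ k → kext ω″ i (enumT k))
      ≡⟨ sumℕ-cong (λ k → countB-sumℕ (λ a → hasExt ω″ a i (enumT k))) ⟩
    sumℕ (λ k → sumℕ (λ a → bit (hasExt ω″ a i (enumT k))))
      ≡⟨ sumℕ-comm (λ k a → bit (hasExt ω″ a i (enumT k))) ⟩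
    sumℕ (λ a → sumℕ (λ k → bit (hasExt ω″ a i (enumT k))))
      ≡⟨ sumℕ-cong (λ a → sumℕ-cong (λ k → cong bit (ext≡ a k))) ⟩
    sumℕ (λ a → sumℕ (λ k → bit (does (label″ a ≟ k) ∧ does (type″ a ≟ i))))
      ≡⟨ sumℕ-cong (λ a → sumℕ-indicator (label″ a) (does (type″ a ≟ i))) ⟩
    sumℕ (λ a → bit (does (type″ a ≟ i)))
      ≡⟨ countB-sumℕ (λ a → does (type″ a ≟ i)) ⟨
    classSize type″ i
      ∎
    where
    open ≡-Reasoning
    ext≡ : ∀ a k → hasExt ω″ a i (enumT k) ≡ does (label″ a ≟ k) ∧ does (type″ a ≟ i)
    ext≡ a k = trans (hasExt-label ω″ a (label″ a) (A″⇔label″ a) i k)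
      (trans (cong₂ _∧_ (does-sym i (type″ a)) (does-sym k (label″ a)))
             (BoolP.∧-comm (does (type″ a ≟ i)) (does (label″ a ≟ k))))

  -- Families pa(a) ∪ {a} in ω″

  family : Fin r → Fin r → Bool
  family a e = Rb ω″ e a ∨ does (e ≟ a)

  family-true : ∀ a e → family a e ≡ true ⇔ (Edge ω″ e a ⊎ e ≡ a)
  family-true a e = mk⇔ to from
    where
    to : family a e ≡ true → Edge ω″ e a ⊎ e ≡ a
    to fam with Rb ω″ e a
    ... | true  = inj₁ refl
    ... | false = inj₂ (from-does-true (e ≟ a) fam)
    from : Edge ω″ e a ⊎ e ≡ a → family a e ≡ true
    from (inj₁ edge) rewrite edge = refl
    from (inj₂ refl) rewrite dec-true (e ≟ e) refl = BoolP.∨-zeroʳ (Rb ω″ e e)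

  family-self : ∀ a → family a a ≡ true
  family-self a = Equivalence.from (family-true a a) (inj₂ refl)

  family-injective : ∀ {a a′} → family a ≗ family a′ → a ≡ a′
  family-injective {a} {a′} same
    with Equivalence.to (family-true a′ a) (trans (sym (same a)) (family-self a))
       | Equivalence.to (family-true a a′) (trans (same a′) (family-self a′))
  ... | inj₂ a≡a′  | _           = a≡a′
  ... | inj₁ _     | inj₂ a′≡a   = sym a′≡a
  ... | inj₁ a→a′  | inj₁ a′→a   = ⊥-elim (acyclic″ a (a→a′ ∷ [ a′→a ]))

  classCount-family : ∀ a i → classCount type″ (family a) i ≡ lookup (parents″ a) i + bit (does (type″ a ≟ i))
  classCount-family a i =
    trans (countB-∨-point (λ e → does (type″ e ≟ i)) (λ e → Rb ω″ e a) a
                          (BoolP.¬-not (λ loop → acyclic″ a [ loop ])))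
          (cong (_+ bit (does (type″ a ≟ i))) (sym (lookup-parents″ a i)))

  -- Rows for a new element of extended 1-type (j, t)

  ifPos : ℕ → ℕ → ℕ
  ifPos zero    _ = 0
  ifPos (suc _) x = x

  module Row (j : Fin u) (t : Vec ℕ u) where

    Protected : (Fin r → Bool) → Set
    Protected S = ∀ a → S a ≡ true → ¬ (S ≗ family a)

    Protected? : ∀ S → Dec (Protected S)
    Protected? S = FinP.all? (λ a → (S a BoolP.≟ true) →-dec ¬? (FinP.all? (λ e → S e BoolP.≟ family a e)))

    Protected-resp : ∀ {S S′} → S ≗ S′ → Protected S → Protected S′
    Protected-resp S≗S′ prot a S′a S′≗fam = prot a (trans (S≗S′ a) S′a) (λ e → trans (S≗S′ e) (S′≗fam e))

    HasParents : (Fin r → Bool) → Set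
    HasParents = HasClassCounts type″ (lookup t)

    HasParents? : ∀ S → Dec (HasParents S)
    HasParents? S = FinP.all? (λ i → classCount type″ S i ℕP.≟ lookup t i)

    Good : (Fin r → Fin b) → Set
    Good row = (∀ e → Admissible (Rxy (row e)) (type″ e) j (row e))
             × HasParents (λ e → Rxy (row e)) × Protected (λ e → Rxy (row e))

    masks : ℕ
    masks = prodℕ (λ i → classSize type″ i C lookup t i)

    count-masks : Count _≗_ HasParents masks
    count-masks = count-classCounts type″ (lookup t)

    good-masks bad-masks : ℕ
    good-masks = countB (λ a → does (Protected? (elem count-masks a)))
    bad-masks  = countB (λ a → not (does (Protected? (elem count-masks a))))

    count-good-masks : Count _≗_ (λ S → HasParents S × Protected S) good-masks
    count-good-masks = count-filter count-masks Protected? (λ S≗S′ → Protected-resp (λ e → sym (S≗S′ e)))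

    count-bad-masks : Count _≗_ (λ S → HasParents S × ¬ Protected S) bad-masks
    count-bad-masks = count-filter count-masks (λ S → ¬? (Protected? S))
                                   (λ S≗S′ unprot prot → unprot (Protected-resp S≗S′ prot))

    bad-families : ℕ
    bad-families = countB (λ a → does (HasParents? (family a)))

    -- a mask is unprotected exactly when it is a family
    count-bad-families : Count _≗_ (λ S → HasParents S × ¬ Protected S) bad-families
    count-bad-families = count-image (count-true (λ a → does (HasParents? (family a)))) family
      (λ a fam → from-does-true (HasParents? (family a)) fam , λ prot → prot a (family-self a) (λ _ → refl))
      (λ _ _ _ _ → family-injective)
      (λ S (has , unprot) → let (a , S≗fam) = family-of S unprot in
        a , dec-true (HasParents? (family a)) (HasClassCounts-resp type″ (lookup t) S≗fam has) ,
        λ { _ refl e → sym (S≗fam e) })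
      where
      family-of : ∀ S → ¬ Protected S → Σ (Fin r) λ a → S ≗ family a
      family-of S unprot
        with FinP.¬∀⟶∃¬ r _ (λ a → (S a BoolP.≟ true) →-dec ¬? (FinP.all? (λ e → S e BoolP.≟ family a e))) unprot
      ... | a , ¬prot-a with FinP.all? (λ e → S e BoolP.≟ family a e)
      ...   | yes S≗fam = a , S≗fam
      ...   | no  S≉fam = ⊥-elim (¬prot-a (λ _ → S≉fam))

    bad-masks≡bad-families : bad-masks ≡ bad-families
    bad-masks≡bad-families = count-unique (λ same e → sym (same e)) (λ same same′ e → trans (same e) (same′ e))
                                          count-bad-masks count-bad-families

    good+bad-masks : good-masks + bad-masks ≡ masks
    good+bad-masks = countB-complement _

    bad-families-≤ : bad-families ≤ masks
    bad-families-≤ = subst₂ _≤_ bad-masks≡bad-families good+bad-masks (ℕP.m≤n+m bad-masks good-masks)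

    good-masks≡ : good-masks ≡ masks ∸ bad-families
    good-masks≡ = begin
      good-masks                                ≡⟨ ℕP.m+n∸n≡m good-masks bad-masks ⟨
      good-masks + bad-masks ∸ bad-masks        ≡⟨ cong₂ _∸_ good+bad-masks bad-masks≡bad-families ⟩
      masks ∸ bad-families                      ∎
      where open ≡-Reasoning

    t⁻ : Fin u → Vec ℕ u
    t⁻ i = updateAt t i (λ x → x ∸ 1)

    t⁻-spec : ∀ i {s} → lookup t i ≡ suc s → ∀ i′ → lookup (t⁻ i) i′ + bit (does (i ≟ i′)) ≡ lookup t i′
    t⁻-spec i {s} tᵢ≡1+s i′ with i ≟ i′
    ... | yes refl = begin
      lookup (t⁻ i) i + 1   ≡⟨ cong (_+ 1) (trans (VecP.lookup∘updateAt i t) (cong (_∸ 1) tᵢ≡1+s)) ⟩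
      s + 1                 ≡⟨ ℕP.+-comm s 1 ⟩
      suc s                 ≡⟨ tᵢ≡1+s ⟨
      lookup t i            ∎
      where open ≡-Reasoning
    ... | no i≢i′ = trans (ℕP.+-identityʳ _) (VecP.lookup∘updateAt′ i′ i (λ i′≡i → i≢i′ (sym i′≡i)) t)

    -- a family of type i has the prescribed class counts iff its owner has extended 1-type (i, t⁻ⁱ)
    bad-families-of-type : ∀ i → classCount type″ (λ a → does (HasParents? (family a))) i
                                 ≡ ifPos (lookup t i) (kext ω″ i (t⁻ i))
    bad-families-of-type i with lookup t i in tᵢ
    ... | zero  = countB-none _ (λ a → BoolP.¬-not (λ bad → no-family a (∧-true bad)))
      where
      no-family : ∀ a → ¬ (does (type″ a ≟ i) ≡ true × does (HasParents? (family a)) ≡ true)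
      no-family a (type? , has?) = ℕP.m+1+n≢0 (lookup (parents″ a) i) (begin
        lookup (parents″ a) i + 1                        ≡⟨ cong (λ x → lookup (parents″ a) i + bit x) type? ⟨
        lookup (parents″ a) i + bit (does (type″ a ≟ i)) ≡⟨ classCount-family a i ⟨
        classCount type″ (family a) i                    ≡⟨ from-does-true (HasParents? (family a)) has? i ⟩
        lookup t i                                       ≡⟨ tᵢ ⟩
        0                                                ∎)
        where open ≡-Reasoning
    ... | suc s =
      countB-cong (λ a → BoolP.⇔→≡ {z = true} (⇔.trans (mk⇔ to (from a)) (⇔.sym (hasExt″ a i (t⁻ i)))))
      where
      to : ∀ {a} → does (type″ a ≟ i) ∧ does (HasParents? (family a)) ≡ true → type″ a ≡ i × parents″ a ≡ t⁻ i
      to {a} bad with (type? , has?) ← ∧-true bad with refl ← from-does-true (type″ a ≟ i) type? =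
        refl , lookup-extensionality (λ i′ → ℕP.+-cancelʳ-≡ (bit (does (i ≟ i′))) _ _ (begin
          lookup (parents″ a) i′ + bit (does (i ≟ i′)) ≡⟨ classCount-family a i′ ⟨
          classCount type″ (family a) i′               ≡⟨ from-does-true (HasParents? (family a)) has? i′ ⟩
          lookup t i′                                  ≡⟨ t⁻-spec i tᵢ i′ ⟨
          lookup (t⁻ i) i′ + bit (does (i ≟ i′))       ∎))
        where open ≡-Reasoning
      from : ∀ a → type″ a ≡ i × parents″ a ≡ t⁻ i → does (type″ a ≟ i) ∧ does (HasParents? (family a)) ≡ true
      from a (refl , parents≡) rewrite dec-true (type″ a ≟ type″ a) refl =
        dec-true (HasParents? (family a)) (λ i′ → begin
          classCount type″ (family a) i′
            ≡⟨ classCount-family a i′ ⟩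
          lookup (parents″ a) i′ + bit (does (i ≟ i′))
            ≡⟨ cong (λ v → lookup v i′ + bit (does (i ≟ i′))) parents≡ ⟩
          lookup (t⁻ i) i′ + bit (does (i ≟ i′))
            ≡⟨ t⁻-spec i tᵢ i′ ⟩
          lookup t i′
            ∎)
        where open ≡-Reasoning

    bad-families-sum : bad-families ≡ sumℕ (λ i → ifPos (lookup t i) (kext ω″ i (t⁻ i)))
    bad-families-sum = trans (countB-by-class type″ _) (sumℕ-cong bad-families-of-type)

    α : Fin u → ℕ
    α i = sumℕ (λ k → kext ω″ i (enumT k))

    weight : ℕ
    weight = prodℕ (λ i → (sumℕ (cs i j) ^ lookup t i) * (sumℕ (ds i j) ^ (α i ∸ lookup t i)))

    Filling : (Fin r → Bool) → (Fin r → Fin b) → Set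
    Filling S row = ∀ e → Admissible (S e) (type″ e) j (row e)

    count-fillings : ∀ S → Count _≗_ (Filling S) (prodℕ (λ e → admissibleCount (S e) (type″ e) j))
    count-fillings S = count-Π (λ e → count-Admissible (S e) (type″ e) j)

    fillings-weight : ∀ S → HasParents S → prodℕ (λ e → admissibleCount (S e) (type″ e) j) ≡ weight
    fillings-weight S has = begin
      prodℕ (λ e → admissibleCount (S e) (type″ e) j)
        ≡⟨ prodℕ-cong (λ e → admissibleCount-if (S e) (type″ e)) ⟩
      prodℕ (λ e → if S e then sumℕ (cs (type″ e) j) else sumℕ (ds (type″ e) j))
        ≡⟨ prodℕ-by-class type″ S (λ i → sumℕ (cs i j)) (λ i → sumℕ (ds i j)) ⟩
      prodℕ (λ i → sumℕ (cs i j) ^ classCount type″ S i * sumℕ (ds i j) ^ classCount type″ (λ e → not (S e)) i)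
        ≡⟨ prodℕ-cong (λ i → cong₂ (λ x y → sumℕ (cs i j) ^ x * sumℕ (ds i j) ^ y) (has i) (non-parents i)) ⟩
      weight
        ∎
      where
      open ≡-Reasoning
      admissibleCount-if : ∀ s i → admissibleCount s i j ≡ (if s then sumℕ (cs i j) else sumℕ (ds i j))
      admissibleCount-if true  i = refl
      admissibleCount-if false i = refl
      non-parents : ∀ i → classCount type″ (λ e → not (S e)) i ≡ α i ∸ lookup t i
      non-parents i = sym (begin
        α i ∸ lookup t i
          ≡⟨ cong (_∸ lookup t i) (classSize-type″ i) ⟩
        classSize type″ i ∸ lookup t i
          ≡⟨ cong (_∸ lookup t i) (countB-partition (λ e → does (type″ e ≟ i)) S) ⟩
        classCount type″ S i + classCount type″ (λ e → not (S e)) i ∸ lookup t i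
          ≡⟨ cong (λ x → x + classCount type″ (λ e → not (S e)) i ∸ lookup t i) (has i) ⟩
        lookup t i + classCount type″ (λ e → not (S e)) i ∸ lookup t i
          ≡⟨ ℕP.m+n∸m≡n (lookup t i) _ ⟩
        classCount type″ (λ e → not (S e)) i
          ∎)

    rows : ℕ
    rows = (masks ∸ bad-families) * weight

    -- a good row is a good mask, namely its R-column, together with an admissible filling of it
    count-rows : Count _≗_ Good rows
    count-rows = subst (Count _≗_ Good) (cong (_* weight) good-masks≡) (count-image
      (count-Σ {Q = Filling} count-good-masks
        (λ S (has , _) → subst (Count _≗_ (Filling S)) (fillings-weight S has) (count-fillings S))
        (λ S≗S′ fill e → subst (λ s → Admissible s (type″ e) j _) (sym (S≗S′ e)) (fill e)))
      proj₂
      (λ (S , row) ((has , prot) , fill) →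
        let S≗Rxy = mask-Rxy S row fill in
        (λ e → subst (λ s → Admissible s (type″ e) j (row e)) (S≗Rxy e) (fill e)) ,
        HasClassCounts-resp type″ (lookup t) S≗Rxy has , Protected-resp S≗Rxy prot)
      (λ (S , row) (S′ , row′) (_ , fill) (_ , fill′) row≗row′ →
        (λ e → trans (mask-Rxy S row fill e) (trans (cong Rxy (row≗row′ e)) (sym (mask-Rxy S′ row′ fill′ e)))) ,
        row≗row′)
      (λ row (adm , has , prot) → ((λ e → Rxy (row e)) , row) , ((has , prot) , adm) , λ _ (_ , row≗) → row≗))
      where
      mask-Rxy : ∀ S row → Filling S row → S ≗ (λ e → Rxy (row e))
      mask-Rxy S row fill e = sym (Admissible-Rxy (S e) (type″ e) j (row e) (fill e))

  -- h c e is the 2-table of the pair (ι″ e, ι′ c)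
  Code : Set
  Code = Fin m → Fin r → Fin b

  module Glue (h : Code) where
    private
      unG : Fin (Vocab.p V) → Fin m ⊎ Fin r → Bool
      unG P (inj₁ c) = Str.un S′ P c
      unG P (inj₂ e) = Str.un S″ P e
      biG : Fin (Vocab.q V) → Fin m ⊎ Fin r → Fin m ⊎ Fin r → Bool
      biG Q (inj₁ c) (inj₁ c′) = Str.bi S′ Q c c′
      biG Q (inj₂ e) (inj₂ e′) = Str.bi S″ Q e e′
      biG Q (inj₂ e) (inj₁ c)  = lookup (proj₁ (to2 (h c e))) Q
      biG Q (inj₁ c) (inj₂ e)  = lookup (proj₂ (to2 (h c e))) Q
      AG : Fin τ → Fin m ⊎ Fin r → Bool
      AG k (inj₁ c) = Interp.A ω′ k c
      AG k (inj₂ e) = Interp.A ω″ k e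

    ω : Interp V τ (m + r)
    ω = record
      { str = record { un = λ P x → unG P (splitAt m x) ; bi = λ Q x y → biG Q (splitAt m x) (splitAt m y) }
      ; A = λ k x → AG k (splitAt m x) }

    S : Str V (m + r)
    S = Interp.str ω

    un-ι′ : ∀ P c → Str.un S P (ι′ c) ≡ Str.un S′ P c
    un-ι′ P c rewrite FinP.splitAt-↑ˡ m c r = refl

    un-ι″ : ∀ P e → Str.un S P (ι″ e) ≡ Str.un S″ P e
    un-ι″ P e rewrite FinP.splitAt-↑ʳ m r e = refl

    A-ι′ : ∀ k c → Interp.A ω k (ι′ c) ≡ Interp.A ω′ k c
    A-ι′ k c rewrite FinP.splitAt-↑ˡ m c r = refl

    A-ι″ : ∀ k e → Interp.A ω k (ι″ e) ≡ Interp.A ω″ k e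
    A-ι″ k e rewrite FinP.splitAt-↑ʳ m r e = refl

    bi-ι′ι′ : ∀ Q c c′ → Str.bi S Q (ι′ c) (ι′ c′) ≡ Str.bi S′ Q c c′
    bi-ι′ι′ Q c c′ rewrite FinP.splitAt-↑ˡ m c r | FinP.splitAt-↑ˡ m c′ r = refl

    bi-ι″ι″ : ∀ Q e e′ → Str.bi S Q (ι″ e) (ι″ e′) ≡ Str.bi S″ Q e e′
    bi-ι″ι″ Q e e′ rewrite FinP.splitAt-↑ʳ m r e | FinP.splitAt-↑ʳ m r e′ = refl

    bi-ι″ι′ : ∀ Q e c → Str.bi S Q (ι″ e) (ι′ c) ≡ lookup (proj₁ (to2 (h c e))) Q
    bi-ι″ι′ Q e c rewrite FinP.splitAt-↑ʳ m r e | FinP.splitAt-↑ˡ m c r = refl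

    bi-ι′ι″ : ∀ Q c e → Str.bi S Q (ι′ c) (ι″ e) ≡ lookup (proj₂ (to2 (h c e))) Q
    bi-ι′ι″ Q c e rewrite FinP.splitAt-↑ʳ m r e | FinP.splitAt-↑ˡ m c r = refl

    restrictˡ : _≈I_ V (restrL V m r ω) ω′
    restrictˡ = un-ι′ , bi-ι′ι′ , A-ι′

    restrictʳ : _≈I_ V (restrR V m r ω) ω″
    restrictʳ = un-ι″ , bi-ι″ι″ , A-ι″

    tb-ι″ι′ : ∀ c e → tb V S (ι″ e) (ι′ c) ≡ to2 (h c e)
    tb-ι″ι′ c e = cong₂ _,_ (trans (VecP.tabulate-cong (λ Q → bi-ι″ι′ Q e c)) (VecP.tabulate∘lookup _))
                            (trans (VecP.tabulate-cong (λ Q → bi-ι′ι″ Q c e)) (VecP.tabulate∘lookup _))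

  glue-injective : ∀ h h′ → _≈I_ V (Glue.ω h) (Glue.ω h′) → ∀ c → h c ≗ h′ c
  glue-injective h h′ (_ , bi≡ , _) c e = begin
    h c e                 ≡⟨ Inverse.strictlyInverseʳ e2 (h c e) ⟨
    from2 (to2 (h c e))   ≡⟨ cong from2 (cong₂ _,_ (lookup-extensionality xy) (lookup-extensionality yx)) ⟩
    from2 (to2 (h′ c e))  ≡⟨ Inverse.strictlyInverseʳ e2 (h′ c e) ⟩
    h′ c e                ∎
    where
    open ≡-Reasoning
    same-table : ∀ Q x y {v v′} → Str.bi (Glue.S h) Q x y ≡ v → Str.bi (Glue.S h′) Q x y ≡ v′ → v ≡ v′
    same-table Q x y v≡ v′≡ = trans (sym v≡) (trans (bi≡ Q x y) v′≡)
    xy : ∀ Q → lookup (proj₁ (to2 (h c e))) Q ≡ lookup (proj₁ (to2 (h′ c e))) Q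
    xy Q = same-table Q (ι″ e) (ι′ c) (Glue.bi-ι″ι′ h Q e c) (Glue.bi-ι″ι′ h′ Q e c)
    yx : ∀ Q → lookup (proj₂ (to2 (h c e))) Q ≡ lookup (proj₂ (to2 (h′ c e))) Q
    yx Q = same-table Q (ι′ c) (ι″ e) (Glue.bi-ι′ι″ h Q c e) (Glue.bi-ι′ι″ h′ Q c e)

  -- Soundness

  GoodCode : Code → Set
  GoodCode h = ∀ c → Row.Good (type′ c) (enumT (label′ c)) (h c)

  Extends : Interp V τ (m + r) → Set
  Extends ω = _≈I_ V (restrL V m r ω) ω′ × _≈I_ V (restrR V m r ω) ω″ × Ψ φ m r ω

  module Sound (h : Code) (good : GoodCode h) where
    open Glue h

    tp-ι″ : ∀ e → tp V S (ι″ e) ≡ tp V S″ e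
    tp-ι″ = tp-induced V (induced-ι″ ω restrictʳ)

    cross : ∀ c e → ⟦_⟧ V (if Rxy (h c e) then χ→ else χ∅) S (env V (ι″ e) (ι′ c))
    cross c e = Ent2-apply V S (ι″ e) (ι′ c) (ι″≢ι′ e c) _
                  (tp-type-ι″ ω restrictʳ e) (tp-type-ι′ ω restrictˡ c) (tb-ι″ι′ c e)
                  (Admissible-Ent2 _ _ _ _ (proj₁ (good c) e))

    cross-φ : ∀ c e → ⟦_⟧ V (pairForm V φ) S (env V (ι″ e) (ι′ c))
    cross-φ c e with Rxy (h c e) | cross c e
    ... | true  | φ , _ = φ
    ... | false | φ , _ = φ

    no-new→old : ∀ c e → ¬ Edge ω (ι′ c) (ι″ e)
    no-new→old c e with Rxy (h c e) | cross c e
    ... | true  | _ , _ , ¬yx = ¬yx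
    ... | false | _ , _ , ¬yx = ¬yx

    sat : SatAll φ ω
    sat x y with side x | side y
    ... | new c | new c′ =
      Equivalence.to (⟦⟧-induced V ι′-injective (induced-ι′ ω restrictˡ) φ (env-∘ V ι′ c c′)) (proj₁ (sat′ c c′))
    ... | old e | old e′ =
      Equivalence.to (⟦⟧-induced V ι″-injective (induced-ι″ ω restrictʳ) φ (env-∘ V ι″ e e′)) (sat″ e e′)
    ... | old e | new c = proj₁ (pairForm-elim V S φ (ι″ e) (ι′ c) (cross-φ c e))
    ... | new c | old e = proj₂ (pairForm-elim V S φ (ι″ e) (ι′ c) (cross-φ c e))

    sink : ∀ c y → ¬ Edge ω (ι′ c) y
    sink c y edge with side y
    ... | new c′ = proj₂ (sat′ c c′) (trans (sym (bi-ι′ι′ R c c′)) edge)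
    ... | old e  = no-new→old c e edge

    no-path-from-new : ∀ {x z} → TransClosure (Edge ω) x z → ∀ {c} → x ≢ ι′ c
    no-path-from-new [ edge ]     refl = sink _ _ edge
    no-path-from-new (edge ∷ _)   refl = sink _ _ edge

    path-old : ∀ {x z} → TransClosure (Edge ω) x z →
               ∀ {e e′} → x ≡ ι″ e → z ≡ ι″ e′ → TransClosure (Edge ω″) e e′
    path-old [ edge ] refl refl = [ trans (sym (bi-ι″ι″ R _ _)) edge ]
    path-old (_∷_ {y = y} edge path) refl z≡ with side y
    ... | new c  = ⊥-elim (no-path-from-new path refl)
    ... | old e″ = trans (sym (bi-ι″ι″ R _ _)) edge ∷ path-old path refl z≡

    acyclic : ∀ x → ¬ TransClosure (Edge ω) x x
    acyclic x cycle with side x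
    ... | new c = no-path-from-new cycle refl
    ... | old e = acyclic″ e (path-old cycle refl refl)

    essential : ∀ a z → ¬ Unprotected ω a z
    essential a z (edge , parents) with side z | side a
    ... | _      | new c  = sink c _ edge
    ... | old e  | old a′ = proj₁ (proj₂ dag″) a′ e (trans (sym (bi-ι″ι″ R a′ e)) edge ,
          λ x → ⇔.trans (≡-⇔ (sym (bi-ι″ι″ R x e))) (⇔.trans (parents (ι″ x)) (family-ι″ ω (bi-ι″ι″ R) x a′)))
    ... | new c  | old a′ = proj₂ (proj₂ (good c)) a′ (trans (sym (bi-ι″ι′ R a′ c)) edge)
          (λ e → BoolP.⇔→≡ {z = true} (⇔.trans (≡-⇔ (sym (bi-ι″ι′ R e c)))
                   (⇔.trans (parents (ι″ e)) (⇔.trans (family-ι″ ω (bi-ι″ι″ R) e a′) (⇔.sym (family-true a′ e))))))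

    count-parents : ∀ (X : Fin (m + r) → Bool) y →
                    countB (λ x → X x ∧ Rb ω x y) ≡ countB (λ e → X (ι″ e) ∧ Rb ω (ι″ e) y)
    count-parents = count-parents-of-sinks ω (λ c y → BoolP.¬-not (sink c y))

    parents-of-new : ∀ c i → countB (λ x → realizes S x i ∧ Rb ω x (ι′ c)) ≡ lookup (enumT (label′ c)) i
    parents-of-new c i = begin
      countB (λ x → realizes S x i ∧ Rb ω x (ι′ c))
        ≡⟨ count-parents (λ x → realizes S x i) (ι′ c) ⟩
      countB (λ e → realizes S (ι″ e) i ∧ Rb ω (ι″ e) (ι′ c))
        ≡⟨ countB-cong (λ e → cong₂ _∧_ (realizes-cong {S = S} {S″} (tp-ι″ e)) (bi-ι″ι′ R e c)) ⟩
      countB (λ e → realizes S″ e i ∧ Rxy (h c e))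
        ≡⟨ countB-realizes S″ (λ e → Rxy (h c e)) i ⟩
      classCount type″ (λ e → Rxy (h c e)) i
        ≡⟨ proj₁ (proj₂ (good c)) i ⟩
      lookup (enumT (label′ c)) i
        ∎
      where open ≡-Reasoning

    parents-of-old : ∀ e i → countB (λ x → realizes S x i ∧ Rb ω x (ι″ e))
                             ≡ countB (λ e′ → realizes S″ e′ i ∧ Rb ω″ e′ e)
    parents-of-old e i = trans (count-parents (λ x → realizes S x i) (ι″ e))
      (countB-cong (λ e′ → cong₂ _∧_ (realizes-cong {S = S} {S″} (tp-ι″ e′)) (bi-ι″ι″ R e′ e)))

    indegree : ∀ z → countB (λ x → Rb ω x z) ≤ d
    indegree z with side z
    ... | old e = subst (_≤ d)
                    (sym (trans (count-parents (λ _ → true) (ι″ e)) (countB-cong (λ e′ → bi-ι″ι″ R e′ e))))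
                    (proj₂ (proj₂ dag″) e)
    ... | new c = subst (_≤ d) (sym in-degree) (Equivalence.from (T-bounded (enumT (label′ c))) (label′ c , refl))
      where
      in-degree : countB (λ x → Rb ω x (ι′ c)) ≡ Vec.sum (enumT (label′ c))
      in-degree = begin
        countB (λ x → Rb ω x (ι′ c))
          ≡⟨ countB-by-class (type S) (λ x → Rb ω x (ι′ c)) ⟩
        sumℕ (λ i → classCount (type S) (λ x → Rb ω x (ι′ c)) i)
          ≡⟨ sumℕ-cong (λ i → trans (sym (countB-realizes S _ i)) (parents-of-new c i)) ⟩
        sumℕ (lookup (enumT (label′ c)))
          ≡⟨ sum-tabulate (lookup (enumT (label′ c))) ⟨
        Vec.sum (tabulate (lookup (enumT (label′ c))))
          ≡⟨ cong Vec.sum (VecP.tabulate∘lookup (enumT (label′ c))) ⟩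
        Vec.sum (enumT (label′ c))
          ∎
        where open ≡-Reasoning

    condC : CondC ω
    condC y k with side y
    ... | old e = mk⇔ (λ A i → trans (parents-of-old e i) (Equivalence.to (condC″ e k) (trans (sym (A-ι″ k e)) A) i))
                      (λ counts → trans (A-ι″ k e)
                                    (Equivalence.from (condC″ e k) (λ i → trans (sym (parents-of-old e i)) (counts i))))
    ... | new c = ⇔.trans (mk⇔ (trans (sym (A-ι′ k c))) (trans (A-ι′ k c))) (⇔.trans (A′⇔label′ c k)
                    (mk⇔ (λ { refl i → parents-of-new c i })
                         (λ counts → enumT-injective
                                       (lookup-extensionality (λ i → trans (sym (counts i)) (parents-of-new c i))))))

    extends : Extends ω
    extends = restrictˡ , restrictʳ , sat , (acyclic , essential , indegree) , condC , (λ c y → BoolP.¬-not (sink c y))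

  -- Completeness

  module Complete (ω : Interp V τ (m + r)) (extends : Extends ω) where
    private
      S = Interp.str ω
      ω↓′ = proj₁ extends
      ω↓″ = proj₁ (proj₂ extends)
      satω = proj₁ (proj₂ (proj₂ extends))
      essentialω = proj₁ (proj₂ (proj₁ (proj₂ (proj₂ (proj₂ extends)))))
      condCω = proj₁ (proj₂ (proj₂ (proj₂ (proj₂ extends))))
      sinksω = proj₂ (proj₂ (proj₂ (proj₂ (proj₂ extends))))

    code : Code
    code c e = from2 (tb V S (ι″ e) (ι′ c))

    to2-code : ∀ c e → to2 (code c e) ≡ tb V S (ι″ e) (ι′ c)
    to2-code c e = Inverse.strictlyInverseˡ e2 _

    Rxy-code : ∀ c e → Rxy (code c e) ≡ Rb ω (ι″ e) (ι′ c)
    Rxy-code c e = trans (cong (λ tl → lookup (proj₁ tl) R) (to2-code c e)) (VecP.lookup∘tabulate _ R)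

    tp-ι″ : ∀ e → tp V S (ι″ e) ≡ tp V S″ e
    tp-ι″ = tp-induced V (induced-ι″ ω ω↓″)

    sink : ∀ c y → ¬ Edge ω (ι′ c) y
    sink c y edge with () ← trans (sym edge) (sinksω c y)

    admissible : ∀ c e → Admissible (Rxy (code c e)) (type″ e) (type′ c) (code c e)
    admissible c e = subst (λ s → Admissible s (type″ e) (type′ c) (code c e)) (sym (Rxy-code c e))
                           (by-edge (Rb ω (ι″ e) (ι′ c)) refl)
      where
      φ-pair : ⟦_⟧ V (pairForm V φ) S (env V (ι″ e) (ι′ c))
      φ-pair = pairForm-intro V S φ (ι″ e) (ι′ c) (ι″≢ι′ e c) (satω _ _) (satω _ _) (satω _ _) (satω _ _)
      entails : ∀ χ → ⟦_⟧ V χ S (env V (ι″ e) (ι′ c)) → Ent2 V (to1 (type″ e)) (to1 (type′ c)) (to2 (code c e)) χ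
      entails χ = Ent2-intro V S (ι″ e) (ι′ c) (ι″≢ι′ e c) χ
                    (tp-type-ι″ ω ω↓″ e) (tp-type-ι′ ω ω↓′ c) (sym (to2-code c e))
      by-edge : ∀ s → Rb ω (ι″ e) (ι′ c) ≡ s → Admissible s (type″ e) (type′ c) (code c e)
      by-edge true  edge    = Indicator-complete (cs-spec _ _ _) (entails χ→ (φ-pair , edge , sink c (ι″ e)))
      by-edge false no-edge =
        Indicator-complete (ds-spec _ _ _) (entails χ∅ (φ-pair , (λ edge → BoolP.not-¬ edge no-edge) , sink c (ι″ e)))

    has-parents : ∀ c → Row.HasParents (type′ c) (enumT (label′ c)) (λ e → Rxy (code c e))
    has-parents c i = begin
      classCount type″ (λ e → Rxy (code c e)) i
        ≡⟨ countB-cong (λ e → cong₂ _∧_ (sym (realizes-type S″ e i)) (Rxy-code c e)) ⟩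
      countB (λ e → realizes S″ e i ∧ Rb ω (ι″ e) (ι′ c))
        ≡⟨ countB-cong (λ e → cong (_∧ Rb ω (ι″ e) (ι′ c)) (realizes-cong {S = S} {S″} (tp-ι″ e))) ⟨
      countB (λ e → realizes S (ι″ e) i ∧ Rb ω (ι″ e) (ι′ c))
        ≡⟨ count-parents-of-sinks ω sinksω (λ x → realizes S x i) (ι′ c) ⟨
      countB (λ x → realizes S x i ∧ Rb ω x (ι′ c))
        ≡⟨ Equivalence.to (condCω (ι′ c) (label′ c)) A-label′ i ⟩
      lookup (enumT (label′ c)) i
        ∎
      where
      open ≡-Reasoning
      A-label′ : Interp.A ω (label′ c) (ι′ c) ≡ true
      A-label′ = trans (proj₂ (proj₂ ω↓′) (label′ c) c) (Equivalence.from (A′⇔label′ c (label′ c)) refl)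

    protected : ∀ c → Row.Protected (type′ c) (enumT (label′ c)) (λ e → Rxy (code c e))
    protected c a parent Rxy≗fam = essentialω (ι″ a) (ι′ c) (trans (sym (Rxy-code c a)) parent , parents)
      where
      parents : ∀ x → Edge ω x (ι′ c) ⇔ (Edge ω x (ι″ a) ⊎ x ≡ ι″ a)
      parents x with side x
      ... | new c′ = mk⇔ (λ edge → ⊥-elim (sink c′ _ edge))
                         (λ { (inj₁ edge) → ⊥-elim (sink c′ _ edge) ; (inj₂ same) → ⊥-elim (ι′≢ι″ c′ a same) })
      ... | old e = ⇔.trans (≡-⇔ (sym (Rxy-code c e))) (⇔.trans (≡-⇔ (Rxy≗fam e))
                      (⇔.trans (family-true a e) (⇔.sym (family-ι″ ω (proj₁ (proj₂ ω↓″) R) e a))))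

    good : GoodCode code
    good c = admissible c , has-parents c , protected c

    glued : ∀ h → (∀ c → h c ≗ code c) → _≈I_ V (Glue.ω h) ω
    glued h h≗code = un≈ , bi≈ , A≈
      where
      open Glue h using (un-ι′; un-ι″; A-ι′; A-ι″; bi-ι′ι′; bi-ι″ι″; bi-ι″ι′; bi-ι′ι″)
      un≈ : ∀ P x → Str.un (Glue.S h) P x ≡ Str.un S P x
      un≈ P x with side x
      ... | new c = trans (un-ι′ P c) (sym (proj₁ ω↓′ P c))
      ... | old e = trans (un-ι″ P e) (sym (proj₁ ω↓″ P e))
      A≈ : ∀ k x → Interp.A (Glue.ω h) k x ≡ Interp.A ω k x
      A≈ k x with side x
      ... | new c = trans (A-ι′ k c) (sym (proj₂ (proj₂ ω↓′) k c))
      ... | old e = trans (A-ι″ k e) (sym (proj₂ (proj₂ ω↓″) k e))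
      bi≈ : ∀ Q x y → Str.bi (Glue.S h) Q x y ≡ Str.bi S Q x y
      bi≈ Q x y with side x | side y
      ... | new c | new c′ = trans (bi-ι′ι′ Q c c′) (sym (proj₁ (proj₂ ω↓′) Q c c′))
      ... | old e | old e′ = trans (bi-ι″ι″ Q e e′) (sym (proj₁ (proj₂ ω↓″) Q e e′))
      ... | old e | new c  = trans (bi-ι″ι′ Q e c) (trans (cong (λ l → lookup (proj₁ (to2 l)) Q) (h≗code c e))
                               (trans (cong (λ tl → lookup (proj₁ tl) Q) (to2-code c e)) (VecP.lookup∘tabulate _ Q)))
      ... | new c | old e  = trans (bi-ι′ι″ Q c e) (trans (cong (λ l → lookup (proj₂ (to2 l)) Q) (h≗code c e))
                               (trans (cong (λ tl → lookup (proj₂ tl) Q) (to2-code c e)) (VecP.lookup∘tabulate _ Q)))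

  rowsOf : Fin m → ℕ
  rowsOf c = Row.rows (type′ c) (enumT (label′ c))

  count-extensions : Count (_≈I_ V) Extends (prodℕ rowsOf)
  count-extensions = count-image (count-Π (λ c → Row.count-rows (type′ c) (enumT (label′ c)))) Glue.ω
    Sound.extends
    (λ h h′ _ _ → glue-injective h h′)
    (λ ω ext → Complete.code ω ext , Complete.good ω ext , Complete.glued ω ext)

  open Formula (λ i j → sumℕ (cs i j)) (λ i j → sumℕ (ds i j)) (kext ω′) (kext ω″)

  pos-ifPos : ∀ n x → pos (ifPos n x) ≡ whenPos n (pos x)
  pos-ifPos zero    x = refl
  pos-ifPos (suc n) x = refl

  rows-closed : ∀ j k → pos (Row.rows j (enumT k)) ≡ g (enumT k) ℤ.* pos (Row.weight j (enumT k))
  rows-closed j k = begin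
    pos ((masks ∸ bad-families) * weight)
      ≡⟨ ℤP.pos-* (masks ∸ bad-families) weight ⟩
    pos (masks ∸ bad-families) ℤ.* pos weight
      ≡⟨ cong (ℤ._* pos weight) (pos-∸ bad-families-≤) ⟩
    (pos masks ℤ.- pos bad-families) ℤ.* pos weight
      ≡⟨ cong₂ (λ x y → (x ℤ.- y) ℤ.* pos weight) masks-closed bad-closed ⟩
    g t ℤ.* pos weight
      ∎
    where
    open ≡-Reasoning
    t = enumT k
    open Row j t using (masks; bad-families; bad-families-≤; weight; bad-families-sum; t⁻)
    masks-closed : pos masks ≡ prodℤ (λ i → pos (α″ i C lookup t i))
    masks-closed = trans (pos-prodℕ (λ i → classSize type″ i C lookup t i))
                         (prodℤ-cong (λ i → cong (λ a → pos (a C lookup t i)) (sym (classSize-type″ i))))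
    bad-closed : pos bad-families ≡ sumℤ (λ i → whenPos (lookup t i) (pos (kext ω″ i (t⁻ i))))
    bad-closed = trans (cong pos bad-families-sum)
                       (trans (pos-sumℕ (λ i → ifPos (lookup t i) (kext ω″ i (t⁻ i))))
                              (sumℤ-cong (λ i → pos-ifPos (lookup t i) (kext ω″ i (t⁻ i)))))

  -- the rows of all new elements of the same extended 1-type contribute the same factor
  count-closed : pos (prodℕ rowsOf) ≡ N
  count-closed = begin
    pos (prodℕ rowsOf)
      ≡⟨ cong pos (prodℕ-regroup rows type′ label′) ⟩
    pos (prodℕ (λ j → prodℕ (λ k → rows j k ^ countB (λ c → does (j ≟ type′ c) ∧ does (k ≟ label′ c)))))
      ≡⟨ cong pos (prodℕ-cong (λ j → prodℕ-cong (λ k → cong (rows j k ^_) (countB-cong (λ c → sym (ext′ c j k)))))) ⟩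
    pos (prodℕ (λ j → prodℕ (λ k → factor j k)))
      ≡⟨ trans (pos-prodℕ (λ j → prodℕ (factor j))) (prodℤ-cong (λ j → pos-prodℕ (factor j))) ⟩
    prodℤ (λ j → prodℤ (λ k → pos (factor j k)))
      ≡⟨ prodℤ-cong (λ j → prodℤ-cong (λ k → trans (pos-^ (rows j k) (kext ω′ j (enumT k)))
                                                   (cong (ℤ._^ kext ω′ j (enumT k)) (rows-closed j k)))) ⟩
    N
      ∎
    where
    open ≡-Reasoning
    rows : Fin u → Fin τ → ℕ
    rows j k = Row.rows j (enumT k)
    factor : Fin u → Fin τ → ℕ
    factor j k = rows j k ^ kext ω′ j (enumT k)
    ext′ : ∀ c j k → hasExt ω′ c j (enumT k) ≡ does (j ≟ type′ c) ∧ does (k ≟ label′ c)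
    ext′ c = hasExt-label ω′ c (label′ c) (A′⇔label′ c)


open import Data.Integer using (+_)
open import Data.Vec using (sum)

proposition4 : (V : Vocab) (φ : QF V)
    → _⊨_ V (pairForm V φ) (neg (bi (Vocab.R V) vx vx))
    → (u : ℕ) (e1 : Fin u ↔ OneType V)
    → (b : ℕ) (e2 : Fin b ↔ TwoTable V)
    → (d τ : ℕ) (enumT : Fin τ → Vec ℕ u)
    → Injective _≡_ _≡_ enumT
    → (∀ t → (sum t ≤ d) ⇔ Σ (Fin τ) (λ k → enumT k ≡ t))
    → (cs ds : Fin u → Fin u → Fin b → ℕ)
    → (∀ i j l →
         let χ = pairForm V φ and (bi (Vocab.R V) vx vy and neg (bi (Vocab.R V) vy vx)) in
         (Ent2 V (Inverse.to e1 i) (Inverse.to e1 j) (Inverse.to e2 l) χ × cs i j l ≡ 1)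
         ⊎ (¬ Ent2 V (Inverse.to e1 i) (Inverse.to e1 j) (Inverse.to e2 l) χ × cs i j l ≡ 0))
    → (∀ i j l →
         let χ = pairForm V φ and (neg (bi (Vocab.R V) vx vy) and neg (bi (Vocab.R V) vy vx)) in
         (Ent2 V (Inverse.to e1 i) (Inverse.to e1 j) (Inverse.to e2 l) χ × ds i j l ≡ 1)
         ⊎ (¬ Ent2 V (Inverse.to e1 i) (Inverse.to e1 j) (Inverse.to e2 l) χ × ds i j l ≡ 0))
    → (m r : ℕ) → 1 ≤ m
    → (ω′ : Interp V τ m)
    → Ctx.SatAll V e1 enumT d (φ and neg (bi (Vocab.R V) vx vy)) ω′
    → (∀ c → Σ (Fin τ) (λ k → (Interp.A ω′ k c ≡ true)
                               × (∀ k′ → Interp.A ω′ k′ c ≡ true → k′ ≡ k)))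
    → (ω″ : Interp V τ r)
    → Ctx.SatAll V e1 enumT d φ ω″
    → Ctx.EssentialDAG V e1 enumT d ω″
    → Ctx.CondC V e1 enumT d ω″
    → Σ ℕ (λ N →
         IsCount V (λ ω → _≈I_ V (restrL V m r ω) ω′ × _≈I_ V (restrR V m r ω) ω″
                          × Ctx.Ψ V e1 enumT d φ m r ω) N
         × (+ N ≡ Ctx.Formula.N V e1 enumT d
                    (λ i j → sumℕ (cs i j)) (λ i j → sumℕ (ds i j))
                    (Ctx.kext V e1 enumT d ω′) (Ctx.kext V e1 enumT d ω″)))
proposition4 V φ _ u e1 b e2 d τ enumT enumT-injective T-bounded cs ds cs-spec ds-spec
             m r _ ω′ sat′ label′-unique ω″ sat″ dag″ condC″ =
  prodℕ rowsOf , (elem K , valid K , distinct K , complete K) , count-closed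
  where
  open Extension V φ e1 e2 d enumT enumT-injective T-bounded cs ds cs-spec ds-spec
                 ω′ sat′ label′-unique ω″ sat″ dag″ condC″
  K = count-extensions
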